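{- Let $m>2$ be an integer and $n=3m$. For integers $a,b,c$ put $u=\frac{a+b+c}{3}$, and call the triple $(a,b,c)$ admissible if (1) $a\equiv 1\pmod 3$, (2) $b\equiv 1\pmod 3$, (3) $c\equiv 1\pmod 3$, (4) $\gcd(u,m)=1$, (5) $1\le a\le n-2$, (6) $1\le b\le n-2$, (7) $1\le c\le n-2$, (8) $a\neq b$, (9) $b\neq c$, (10) $c\neq a$. Then the equivalence classes of $m$-circular $3m$-polygons are represented by the $n$-tuples $(a,b,c,\,a,b,c,\,\ldots,\,a,b,c)$ (the block $(a,b,c)$ repeated $m$ times) with $(a,b,c)$ admissible, in the following sense: for every admissible triple this $n$-tuple represents an $m$-circular $3m$-polygon, and every $m$-circular $3m$-polygon is equivalent to the polygon represented by such a tuple for some admissible triple.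
   Context: Let $n\ge 3$ and $V_n=\{v_k=e^{2\pi i k/n}: k=0,\dots,n-1\}\subset\mathbb{C}$ (indices taken mod $n$). An $n$-polygon is a closed polygonal path visiting every point of $V_n$ exactly once: for a cyclic ordering $(\sigma_1,\dots,\sigma_n)$ of $\{0,\dots,n-1\}$ it is the union of the segments $[v_{\sigma_i},v_{\sigma_{i+1}}]$, $i=1,\dots,n$, with $\sigma_{n+1}=\sigma_1$. Its sides are the numbers $e_i\in\{1,\dots,n-1\}$ with $e_i\equiv\sigma_{i+1}-\sigma_i \pmod n$. An $n$-tuple $(e_1,\dots,e_n)$ with entries in $\{1,\dots,n-1\}$ represents the polygon obtained by starting at $v_0$ and moving successively to $v_{s_1},v_{s_2},\dots,v_{s_n}$ where $s_k=e_1+\dots+e_k$; this is an $n$-polygon iff $n\nmid s_k$ for $1\le k\le n-1$ and $n\mid s_n$, and then $s_n/n$ is the number of revolutions. Two $n$-polygons are equivalent if one is obtained from the other by a rotation about $0$ (reflections not allowed). A symmetry axis of an $n$-polygon is a line through $0$ such that reflection in it maps the polygon (as a union of segments) onto itself. For $m>2$ and $n=3m$, an $m$-circular $3m$-polygon is a $3m$-polygon that has no symmetry axis and is mapped onto itself by the rotations about $0$ through the angles $\frac{3\cdot 2\pi i}{n}$, $i=1,\dots,m$. -}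

module Defs where

open import Data.Nat as ℕ using (ℕ; zero; suc; _<_; _≤_; _%_; _/_; _≟_)
open import Data.Nat.GCD using (gcd)
open import Data.Integer as ℤ using (ℤ; +_)
open import Data.Integer.Divisibility as ℤD using ()
open import Data.Product using (_×_; ∃; ∃-syntax)
open import Data.Sum using (_⊎_)
open import Relation.Nullary using (¬_; yes; no)
open import Relation.Binary.PropositionalEquality using (_≡_)
open import Function.Bundles using (_⇔_)

-- Vertex v_k is represented by its label k : ℤ, read modulo n.
-- Congruence of labels modulo n (i.e. equality of vertices v_x = v_y).
Cong : ℕ → ℤ → ℤ → Set
Cong n x y = (+ n) ℤD.∣ (x ℤ.- y)

nxt : ℕ → ℕ → ℕ
nxt n i with suc i ≟ n
... | yes _ = 0
... | no  _ = suc i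

-- A "vertex sequence" σ : ℕ → ℤ, used on indices 0,…,n-1, describes the closed
-- path v_{σ 0} → v_{σ 1} → … → v_{σ (n-1)} → v_{σ 0}.
-- It is an n-polygon iff it is a cyclic ordering of V_n, i.e. visits every
-- vertex exactly once (injective mod n on {0,…,n-1}, hence bijective).
IsPolygon : ℕ → (ℕ → ℤ) → Set
IsPolygon n σ = ∀ i j → i < n → j < n → Cong n (σ i) (σ j) → i ≡ j

HasEdge : ℕ → (ℕ → ℤ) → ℤ → ℤ → Set
HasEdge n σ x y = ∃[ i ] (i < n ×
  ((Cong n x (σ i) × Cong n y (σ (nxt n i))) ⊎
   (Cong n x (σ (nxt n i)) × Cong n y (σ i))))

-- The map of V_n given on labels by g maps the polygon σ onto the polygon τ
-- (as unions of segments, equivalently as sets of sides).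
MapsOnto : ℕ → (ℤ → ℤ) → (ℕ → ℤ) → (ℕ → ℤ) → Set
MapsOnto n g σ τ = ∀ x y → HasEdge n σ x y ⇔ HasEdge n τ (g x) (g y)

-- rotation about 0 through the angle 2πt/n
rot : ℤ → ℤ → ℤ
rot t x = x ℤ.+ t

-- reflection in the line through 0 with angle πr/n : v_x ↦ v_{r-x}
refl : ℤ → ℤ → ℤ
refl r x = r ℤ.- x

HasSymmetryAxis : ℕ → (ℕ → ℤ) → Set
HasSymmetryAxis n σ = ∃[ r ] MapsOnto n (refl r) σ σ

Equivalent : ℕ → (ℕ → ℤ) → (ℕ → ℤ) → Set
Equivalent n σ τ = ∃[ t ] MapsOnto n (rot t) σ τ

-- m-circular 3m-polygon (the polygon σ is assumed to be a 3m-polygon separately)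
MCircular : ℕ → (ℕ → ℤ) → Set
MCircular m σ = ¬ HasSymmetryAxis (3 ℕ.* m) σ ×
  (∀ i → 1 ≤ i → i ≤ m → MapsOnto (3 ℕ.* m) (rot (+ (3 ℕ.* i))) σ σ)

-- tuples (e_1,…,e_n) are given as functions e : ℕ → ℕ on positions 0,…,n-1
-- partial sums s_k = e_1 + … + e_k   (s_0 = 0)
psum : (ℕ → ℕ) → ℕ → ℕ
psum e zero    = 0
psum e (suc k) = psum e k ℕ.+ e k

tupleVerts : (ℕ → ℕ) → ℕ → ℤ
tupleVerts e k = + psum e k

RepresentsPolygon : ℕ → (ℕ → ℕ) → Set
RepresentsPolygon n e = IsPolygon n (tupleVerts e) × Cong n (+ psum e n) (+ 0)

rep3 : ℕ → ℕ → ℕ → ℕ → ℕ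
rep3 a b c k with k % 3
... | 0 = a
... | 1 = b
... | _ = c

Admissible : ℕ → ℕ → ℕ → ℕ → Set
Admissible m a b c =
  a % 3 ≡ 1 × b % 3 ≡ 1 × c % 3 ≡ 1 ×
  gcd ((a ℕ.+ b ℕ.+ c) / 3) m ≡ 1 ×
  (1 ≤ a × a ≤ 3 ℕ.* m ℕ.∸ 2) ×
  (1 ≤ b × b ≤ 3 ℕ.* m ℕ.∸ 2) ×
  (1 ≤ c × c ≤ 3 ℕ.* m ℕ.∸ 2) ×
  ¬ a ≡ b × ¬ b ≡ c × ¬ c ≡ a

module Submission where

-- A closed path is read as a vertex sequence g : ℤ → ℤ, periodic modulo n = 3m. The key objects
-- are the paths whose k-th side is the k-th entry of (a, b, c, a, b, c, …). Three steps advance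
-- such a path by a + b + c = 3u; if every side is ≡ 1 (mod 3) and u is a unit modulo m, then g k
-- determines k modulo 3 and hence modulo n, so the path is a polygon, and its sides are exactly the
-- segments from x to x + side (x - g 0). Rotations through multiples of 3 preserve this description;
-- a reflection reverses the direction of traversal, which is only possible if two of a, b, c agree,
-- and conversely two equal entries make the pattern palindromic, which yields an axis.
--
-- For the converse, the rotation through 3 maps every side g k g (k+1) to a side. Following the
-- path, it acts on indices either as k ↦ k + d or as k ↦ c − k, and the latter would make it an
-- involution, impossible as 6 ≢ 0 (mod n). So g (k + d) ≡ g k + 3, which forces d = 3t with t a
-- unit modulo m and makes the sides 3-periodic. Their residues modulo 3 are then all 1 or all 2;
-- in the second case the reversed path has residues 1, and a translation moves the path onto the
-- one given by the tuple.

open import Data.Nat as ℕ using (ℕ; zero; suc; z≤n; s≤s; NonZero)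
import Data.Nat.Properties as ℕP
import Data.Nat.Divisibility as ℕD
import Data.Nat.DivMod as ℕM
import Data.Nat.Tactic.RingSolver as ℕSolver
open import Data.Nat.GCD using (gcd; module Bézout)
open import Data.Nat.Coprimality using (Coprime; coprime-Bézout; coprime⇒gcd≡1; gcd≡1⇒coprime)
open import Data.Integer as ℤ using (ℤ; +_; -[1+_]; _+_; _-_; _*_; -_; _%ℕ_; _/ℕ_)
import Data.Integer.Properties as ℤP
import Data.Integer.DivMod as ℤM
import Data.Integer.Divisibility.Signed as ℤS
open import Data.Integer.Tactic.RingSolver using (solve-∀)
open import Data.Product using (_×_; _,_; proj₁; proj₂; ∃-syntax)
open import Data.Sum using (_⊎_; inj₁; inj₂)
open import Data.Empty using (⊥; ⊥-elim)
open import Relation.Nullary using (¬_; yes; no; contradiction)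
open import Relation.Binary.PropositionalEquality
open import Function using (_$_; _∘_)
open import Function.Bundles using (_⇔_; mk⇔; Equivalence)
open import Relation.Binary.Bundles using (Setoid)
import Relation.Binary.Reasoning.Setoid
open import Level using (0ℓ)
open import Defs renaming (refl to reflection)

-- Congruence modulo d on ℤ

infix 4 _≡_mod_
-- A record rather than a definition, so that x and y can be inferred from the type.
record _≡_mod_ (x y : ℤ) (d : ℕ) : Set where
  constructor divides-difference
  field difference : + d ℤS.∣ (x - y)

module _ {d : ℕ} where

  private
    transport : ∀ {z z'} → z ≡ z' → + d ℤS.∣ z → + d ℤS.∣ z'
    transport = subst (+ d ℤS.∣_)

  mod-refl : ∀ {x} → x ≡ x mod d
  mod-refl {x} = divides-difference (transport (sym (ℤP.+-inverseʳ x)) (ℤS.∣n⇒∣m*n (+ 0) ℤS.∣-refl))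

  mod-reflexive : ∀ {x y} → x ≡ y → x ≡ y mod d
  mod-reflexive refl = mod-refl

  mod-sym : ∀ {x y} → x ≡ y mod d → y ≡ x mod d
  mod-sym {x} {y} (divides-difference p) = divides-difference (transport (e x y) (ℤS.∣m⇒∣-m p))
    where e : ∀ x y → - (x - y) ≡ y - x
          e = solve-∀

  mod-trans : ∀ {x y z} → x ≡ y mod d → y ≡ z mod d → x ≡ z mod d
  mod-trans {x} {y} {z} (divides-difference p) (divides-difference q) =
    divides-difference (transport (e x y z) (ℤS.∣m∣n⇒∣m+n p q))
    where e : ∀ x y z → (x - y) + (y - z) ≡ x - z
          e = solve-∀

  +-cong-mod : ∀ {x x' y y'} → x ≡ x' mod d → y ≡ y' mod d → x + y ≡ x' + y' mod d
  +-cong-mod {x} {x'} {y} {y'} (divides-difference p) (divides-difference q) =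
    divides-difference (transport (e x x' y y') (ℤS.∣m∣n⇒∣m+n p q))
    where e : ∀ x x' y y' → (x - x') + (y - y') ≡ (x + y) - (x' + y')
          e = solve-∀

  -‿cong-mod : ∀ {x y} → x ≡ y mod d → - x ≡ - y mod d
  -‿cong-mod {x} {y} (divides-difference p) = divides-difference (transport (e x y) (ℤS.∣m⇒∣-m p))
    where e : ∀ x y → - (x - y) ≡ (- x) - (- y)
          e = solve-∀

  *-congˡ-mod : ∀ c {x y} → x ≡ y mod d → c * x ≡ c * y mod d
  *-congˡ-mod c {x} {y} (divides-difference p) = divides-difference (transport (e c x y) (ℤS.∣n⇒∣m*n c p))
    where e : ∀ c x y → c * (x - y) ≡ c * x - c * y
          e = solve-∀

  multiple≡0-mod : ∀ q → q * + d ≡ + 0 mod d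
  multiple≡0-mod q = divides-difference (ℤS.divides q (ℤP.+-identityʳ (q * + d)))

  mod-quotient : ∀ {x y} → x ≡ y mod d → ∃[ q ] x ≡ y + q * + d
  mod-quotient {x} {y} (divides-difference (ℤS.divides q eq)) = q , e x y _ eq
    where e : ∀ x y z → x - y ≡ z → x ≡ y + z
          e x y z refl = e′ x y
            where e′ : ∀ x y → x ≡ y + (x - y)
                  e′ = solve-∀

  +-cancelʳ-mod : ∀ {x y z} → x + z ≡ y + z mod d → x ≡ y mod d
  +-cancelʳ-mod {x} {y} {z} (divides-difference p) = divides-difference (transport (e x y z) p)
    where e : ∀ x y z → (x + z) - (y + z) ≡ x - y
          e = solve-∀

  +-cancelˡ-mod : ∀ {x y z} → z + x ≡ z + y mod d → x ≡ y mod d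
  +-cancelˡ-mod {x} {y} {z} (divides-difference p) = divides-difference (transport (e x y z) p)
    where e : ∀ x y z → (z + x) - (z + y) ≡ x - y
          e = solve-∀

  mod-setoid : Setoid 0ℓ 0ℓ
  mod-setoid = record
    { Carrier = ℤ ; _≈_ = λ x y → x ≡ y mod d
    ; isEquivalence = record { refl = mod-refl ; sym = mod-sym ; trans = mod-trans } }

module mod-Reasoning (n : ℕ) = Relation.Binary.Reasoning.Setoid (mod-setoid {n})

mod-divisor : ∀ {d e x y} → d ℕD.∣ e → x ≡ y mod e → x ≡ y mod d
mod-divisor d∣e (divides-difference p) = divides-difference (ℤS.∣-trans (ℤS.∣ᵤ⇒∣ d∣e) p)

Cong⇒mod : ∀ {n x y} → Cong n x y → x ≡ y mod n
Cong⇒mod p = divides-difference (ℤS.∣ᵤ⇒∣ p)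

mod⇒Cong : ∀ {n x y} → x ≡ y mod n → Cong n x y
mod⇒Cong (divides-difference p) = ℤS.∣⇒∣ᵤ p

*-cong-modulus : ∀ k {m x y} → x ≡ y mod m → + k * x ≡ + k * y mod (k ℕ.* m)
*-cong-modulus k {m} {x} {y} (divides-difference p) = divides-difference
  (subst₂ ℤS._∣_ (sym (ℤP.pos-* k m)) (e (+ k) x y) (ℤS.*-monoʳ-∣ (+ k) p))
  where e : ∀ k x y → k * (x - y) ≡ k * x - k * y
        e = solve-∀

*-cancel-modulus : ∀ k .{{_ : NonZero k}} {m x y} → + k * x ≡ + k * y mod (k ℕ.* m) → x ≡ y mod m
*-cancel-modulus k {m} {x} {y} (divides-difference p) = divides-difference
  (ℤS.*-cancelˡ-∣ (+ k) (subst₂ ℤS._∣_ (ℤP.pos-* k m) (e (+ k) x y) p))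
  where e : ∀ k x y → k * x - k * y ≡ k * (x - y)
        e = solve-∀

instance
  3*-nonZero : ∀ {m} .{{_ : NonZero m}} → NonZero (3 ℕ.* m)
  3*-nonZero {m} = ℕP.m*n≢0 3 m

small-divisible⇒≡0 : ∀ {d k} → d ℕD.∣ k → k ℕ.< d → k ≡ 0
small-divisible⇒≡0 {k = zero}  _   _   = refl
small-divisible⇒≡0 {k = suc _} d∣k k<d = ⊥-elim (ℕD.>⇒∤ k<d d∣k)

private
  mod⇒≡-ordered : ∀ {d r r'} → r ℕ.≤ r' → r' ℕ.< d → + r ≡ + r' mod d → r ≡ r'
  mod⇒≡-ordered {d} {r} r≤r' r'<d (divides-difference p) with ℕP.m≤n⇒∃[o]m+o≡n r≤r'
  ... | k , refl = sym (trans (cong (r ℕ.+_) k≡0) (ℕP.+-identityʳ r))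
    where
      difference≡-k : + r - + (r ℕ.+ k) ≡ - + k
      difference≡-k = trans (cong (λ z → + r - z) (ℤP.pos-+ r k)) (e (+ r) (+ k))
        where e : ∀ x y → x - (x + y) ≡ - y
              e = solve-∀
      k≡0 : k ≡ 0
      k≡0 = small-divisible⇒≡0
        (subst (d ℕD.∣_) (ℤP.∣-i∣≡∣i∣ (+ k)) (ℤS.∣⇒∣ᵤ (subst (+ d ℤS.∣_) difference≡-k p)))
        (ℕP.≤-<-trans (ℕP.m≤n+m k r) r'<d)

mod⇒≡-below : ∀ {d r r'} → r ℕ.< d → r' ℕ.< d → + r ≡ + r' mod d → r ≡ r'
mod⇒≡-below {r = r} {r'} r<d r'<d p with ℕP.≤-total r r'
... | inj₁ r≤r' = mod⇒≡-ordered r≤r' r'<d p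
... | inj₂ r'≤r = sym (mod⇒≡-ordered r'≤r r<d (mod-sym p))

module _ (d : ℕ) .{{_ : NonZero d}} where

  %ℕ-mod : ∀ x → x ≡ + (x %ℕ d) mod d
  %ℕ-mod x = divides-difference (ℤS.divides (x /ℕ d) (e x _ _ (ℤM.a≡a%ℕn+[a/ℕn]*n x d)))
    where e : ∀ x r q → x ≡ r + q → x - r ≡ q
          e x r q refl = e′ r q
            where e′ : ∀ r q → r + q - r ≡ q
                  e′ = solve-∀

  %ℕ-unique : ∀ {x r} → r ℕ.< d → x ≡ + r mod d → x %ℕ d ≡ r
  %ℕ-unique {x} r<d p = mod⇒≡-below (ℤM.n%ℕd<d x d) r<d (mod-trans (mod-sym (%ℕ-mod x)) p)

  %ℕ-cong : ∀ {x y} → x ≡ y mod d → x %ℕ d ≡ y %ℕ d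
  %ℕ-cong {x} {y} p = %ℕ-unique (ℤM.n%ℕd<d y d) (mod-trans p (%ℕ-mod y))

  private
    +1-mod : ∀ k → k + + 1 ≡ + suc (k %ℕ d) mod d
    +1-mod k = mod-trans (+-cong-mod (%ℕ-mod k) mod-refl)
                         (mod-reflexive (cong +_ (ℕP.+-comm (k %ℕ d) 1)))

  %ℕ-+1 : ∀ k → (k + + 1) %ℕ d ≡ nxt d (k %ℕ d)
  %ℕ-+1 k with suc (k %ℕ d) ℕ.≟ d
  ... | yes 1+r≡d = %ℕ-unique (ℕ.>-nonZero⁻¹ d) (mod-trans (+1-mod k)
          (mod-trans (mod-reflexive (trans (cong +_ 1+r≡d) (sym (ℤP.*-identityˡ (+ d))))) (multiple≡0-mod (+ 1))))
  ... | no  1+r≢d = %ℕ-unique (ℕP.≤∧≢⇒< (ℤM.n%ℕd<d k d) 1+r≢d) (+1-mod k)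

nxt-cases : ∀ d i → (suc i ≡ d × nxt d i ≡ 0) ⊎ nxt d i ≡ suc i
nxt-cases d i with suc i ℕ.≟ d
... | yes 1+i≡d = inj₁ (1+i≡d , refl)
... | no  _     = inj₂ refl

ℤ-induction : (P : ℤ → Set) → P (+ 0) → (∀ k → P k → P (k + + 1)) → (∀ k → P (k + + 1) → P k) →
              ∀ k → P k
ℤ-induction P base up down (+ zero)      = base
ℤ-induction P base up down (+ suc j)     =
  subst P (cong +_ (ℕP.+-comm j 1)) (up (+ j) (ℤ-induction P base up down (+ j)))
ℤ-induction P base up down -[1+ zero ]   = down -[1+ zero ] base
ℤ-induction P base up down -[1+ suc j ]  = down -[1+ suc j ] (ℤ-induction P base up down -[1+ j ])

iterate-shift : ∀ {n} (g : ℤ → ℤ) (d e : ℤ) → (∀ k → g (k + d) ≡ g k + e mod n) →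
                ∀ k s → g (k + d * s) ≡ g k + e * s mod n
iterate-shift {n} g d e shift k = ℤ-induction P base up down
  where
    open mod-Reasoning n
    P : ℤ → Set
    P s = g (k + d * s) ≡ g k + e * s mod n
    times0 : ∀ x y → x + y * + 0 ≡ x
    times0 = solve-∀
    times+1 : ∀ x y s → x + y * (s + + 1) ≡ (x + y * s) + y
    times+1 = solve-∀
    base : P (+ 0)
    base = mod-reflexive (trans (cong g (times0 k d)) (sym (times0 (g k) e)))
    up : ∀ s → P s → P (s + + 1)
    up s p = begin
      g (k + d * (s + + 1))   ≡⟨ cong g (times+1 k d s) ⟩
      g ((k + d * s) + d)     ≈⟨ shift _ ⟩
      g (k + d * s) + e       ≈⟨ +-cong-mod p mod-refl ⟩
      (g k + e * s) + e       ≡⟨ times+1 (g k) e s ⟨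
      g k + e * (s + + 1)     ∎
    down : ∀ s → P (s + + 1) → P s
    down s p = +-cancelʳ-mod (begin
      g (k + d * s) + e       ≈⟨ mod-sym (shift _) ⟩
      g ((k + d * s) + d)     ≡⟨ cong g (times+1 k d s) ⟨
      g (k + d * (s + + 1))   ≈⟨ p ⟩
      g k + e * (s + + 1)     ≡⟨ times+1 (g k) e s ⟩
      (g k + e * s) + e       ∎)

coprime⇒inverse : ∀ {t m} → Coprime t m → ∃[ v ] + t * v ≡ + 1 mod m
coprime⇒inverse {t} {m} coprime with coprime-Bézout coprime
... | Bézout.+- x y eq = + x , (begin
  + t * + x               ≡⟨ trans (cong +_ (trans eq (ℕP.*-comm x t))) (ℤP.pos-* t x) ⟨
  + (1 ℕ.+ y ℕ.* m)       ≡⟨ cong (λ z → + 1 + z) (ℤP.pos-* y m) ⟩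
  + 1 + + y * + m         ≈⟨ +-cong-mod (mod-refl {x = + 1}) (multiple≡0-mod (+ y)) ⟩
  + 1 + + 0               ∎)
  where open mod-Reasoning m
... | Bézout.-+ x y eq = - + x , (begin
  + t * - + x             ≡⟨ e (+ t) (+ x) ⟩
  + 1 - (+ 1 + + x * + t) ≡⟨ cong (λ z → + 1 - (+ 1 + z)) (ℤP.pos-* x t) ⟨
  + 1 - + (1 ℕ.+ x ℕ.* t) ≡⟨ cong (λ z → + 1 - + z) eq ⟩
  + 1 - + (y ℕ.* m)       ≈⟨ +-cong-mod (mod-refl {x = + 1}) (-‿cong-mod (mod-trans (mod-reflexive (ℤP.pos-* y m)) (multiple≡0-mod (+ y)))) ⟩
  + 1 - + 0               ∎)
  where open mod-Reasoning m
        e : ∀ t x → t * - x ≡ + 1 - (+ 1 + x * t)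
        e = solve-∀

inverse⇒gcd≡1 : ∀ {u m} (t : ℤ) → + u * t ≡ + 1 mod m → gcd u m ≡ 1
inverse⇒gcd≡1 {u} {m} t (divides-difference m∣ut-1) = coprime⇒gcd≡1 coprime
  where
    coprime : Coprime u m
    coprime {e} (e∣u , e∣m) = ℕD.∣1⇒≡1 (ℤS.∣⇒∣ᵤ (subst (+ e ℤS.∣_) (e′ (+ u * t))
      (ℤS.∣m∣n⇒∣m-n (ℤS.∣m⇒∣m*n {+ e} {+ u} t (ℤS.∣ᵤ⇒∣ e∣u)) (ℤS.∣-trans (ℤS.∣ᵤ⇒∣ e∣m) m∣ut-1))))
      where e′ : ∀ z → z - (z - + 1) ≡ + 1
            e′ = solve-∀

∣⇒≡0-mod : ∀ {n k} → n ℕD.∣ k → + k ≡ + 0 mod n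
∣⇒≡0-mod {n} (ℕD.divides q refl) = mod-trans (mod-reflexive (ℤP.pos-* q n)) (multiple≡0-mod (+ q))

≡0-mod⇒∣ : ∀ {n k} → + k ≡ + 0 mod n → n ℕD.∣ k
≡0-mod⇒∣ {n} {k} p = subst (n ℕD.∣_) (ℕP.+-identityʳ k) (mod⇒Cong p)

-- Residues modulo 3 and the pattern (a, b, c, a, b, c, …)

pick3 : ℕ → ℕ → ℕ → ℕ → ℕ
pick3 a b c zero                = a
pick3 a b c (suc zero)          = b
pick3 a b c (suc (suc _))       = c

pick3-all : ∀ (P : ℕ → Set) {a b c} → P a → P b → P c → ∀ r → P (pick3 a b c r)
pick3-all P pa pb pc zero          = pa
pick3-all P pa pb pc (suc zero)    = pb
pick3-all P pa pb pc (suc (suc _)) = pc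

rep3≡pick3 : ∀ a b c k → rep3 a b c k ≡ pick3 a b c (k ℕ.% 3)
rep3≡pick3 a b c k with k ℕ.% 3
... | zero        = refl
... | suc zero    = refl
... | suc (suc _) = refl

sides3 : ℕ → ℕ → ℕ → ℤ → ℕ
sides3 a b c k = pick3 a b c (k %ℕ 3)

residue3 : ∀ x → x %ℕ 3 ≡ 0 ⊎ x %ℕ 3 ≡ 1 ⊎ x %ℕ 3 ≡ 2
residue3 x with x %ℕ 3 | ℤM.n%ℕd<d x 3
... | zero                | _ = inj₁ refl
... | suc zero            | _ = inj₂ (inj₁ refl)
... | suc (suc zero)      | _ = inj₂ (inj₂ refl)
... | suc (suc (suc _))   | s≤s (s≤s (s≤s ()))

pick3-consecutive-sum : ∀ a b c r → r ℕ.< 3 →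
  pick3 a b c r ℕ.+ pick3 a b c (nxt 3 r) ℕ.+ pick3 a b c (nxt 3 (nxt 3 r)) ≡ a ℕ.+ b ℕ.+ c
pick3-consecutive-sum a b c zero                _ = refl
pick3-consecutive-sum a b c (suc zero)          _ = e b c a
  where e : ∀ b c a → b ℕ.+ c ℕ.+ a ≡ a ℕ.+ b ℕ.+ c
        e = ℕSolver.solve-∀
pick3-consecutive-sum a b c (suc (suc zero))    _ = e c a b
  where e : ∀ c a b → c ℕ.+ a ℕ.+ b ≡ a ℕ.+ b ℕ.+ c
        e = ℕSolver.solve-∀
pick3-consecutive-sum a b c (suc (suc (suc _))) (s≤s (s≤s (s≤s ())))

%3≡⇒mod : ∀ a {r} → a ℕ.% 3 ≡ r → + a ≡ + r mod 3
%3≡⇒mod a h = mod-trans (%ℕ-mod 3 (+ a)) (mod-reflexive (cong +_ h))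

residues1⇒sum%3≡0 : ∀ a b c → a ℕ.% 3 ≡ 1 → b ℕ.% 3 ≡ 1 → c ℕ.% 3 ≡ 1 → (a ℕ.+ b ℕ.+ c) ℕ.% 3 ≡ 0
residues1⇒sum%3≡0 a b c a≡1 b≡1 c≡1 = %ℕ-cong 3 (mod-trans
  (mod-reflexive (trans (ℤP.pos-+ (a ℕ.+ b) c) (cong (_+ + c) (ℤP.pos-+ a b))))
  (+-cong-mod (+-cong-mod (%3≡⇒mod a a≡1) (%3≡⇒mod b b≡1)) (%3≡⇒mod c c≡1)))

below3-cases : ∀ (P : ℕ → Set) → P 0 → P 1 → P 2 → ∀ r → r ℕ.< 3 → P r
below3-cases P p₀ p₁ p₂ zero                _ = p₀
below3-cases P p₀ p₁ p₂ (suc zero)          _ = p₁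
below3-cases P p₀ p₁ p₂ (suc (suc zero))    _ = p₂
below3-cases P p₀ p₁ p₂ (suc (suc (suc _))) (s≤s (s≤s (s≤s ())))

%3≡1⇒≤∸2 : ∀ {a n} → a ℕ.% 3 ≡ 1 → n ℕ.% 3 ≡ 0 → a ℕ.< n → a ℕ.≤ n ℕ.∸ 2
%3≡1⇒≤∸2 {a} {n} a%3≡1 n%3≡0 a<n = ℕP.m+n≤o⇒m≤o∸n a (subst (ℕ._≤ n) (ℕP.+-comm 2 a) (ℕP.≤∧≢⇒< a<n 1+a≢n))
  where
    1+a≢n : ¬ suc a ≡ n
    1+a≢n refl = contradiction (trans (sym n%3≡0) (trans (ℕM.%-distribˡ-+ 1 a 3) (cong (λ r → (1 ℕ.+ r) ℕ.% 3) a%3≡1))) λ ()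

%3≡1⇒≥1 : ∀ {a} → a ℕ.% 3 ≡ 1 → 1 ℕ.≤ a
%3≡1⇒≥1 {zero}  ()
%3≡1⇒≥1 {suc _} _ = s≤s z≤n

AllResidues : ℕ → ℕ → ℕ → ℕ → Set
AllResidues r a b c = a ℕ.% 3 ≡ r × b ℕ.% 3 ≡ r × c ℕ.% 3 ≡ r

private
  classify : ∀ ra rb rc → ra ℕ.< 3 → rb ℕ.< 3 → rc ℕ.< 3 → ¬ ra ≡ 0 → ¬ rb ≡ 0 →
             ¬ (ra ℕ.+ rb) ℕ.% 3 ≡ 0 → (ra ℕ.+ rb ℕ.+ rc) ℕ.% 3 ≡ 0 →
             (ra ≡ 1 × rb ≡ 1 × rc ≡ 1) ⊎ (ra ≡ 2 × rb ≡ 2 × rc ≡ 2)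
  classify (suc (suc (suc _))) _ _ (s≤s (s≤s (s≤s ()))) _ _ _ _ _ _
  classify _ (suc (suc (suc _))) _ _ (s≤s (s≤s (s≤s ()))) _ _ _ _ _
  classify _ _ (suc (suc (suc _))) _ _ (s≤s (s≤s (s≤s ()))) _ _ _ _
  classify zero _ _ _ _ _ ra≢0 _ _ _                        = ⊥-elim (ra≢0 refl)
  classify _ zero _ _ _ _ _ rb≢0 _ _                        = ⊥-elim (rb≢0 refl)
  classify 1 2 _ _ _ _ _ _ ra+rb≢0 _                        = ⊥-elim (ra+rb≢0 refl)
  classify 2 1 _ _ _ _ _ _ ra+rb≢0 _                        = ⊥-elim (ra+rb≢0 refl)
  classify 1 1 1 _ _ _ _ _ _ _                              = inj₁ (refl , refl , refl)
  classify 2 2 2 _ _ _ _ _ _ _                              = inj₂ (refl , refl , refl)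
  classify 1 1 zero _ _ _ _ _ _ ()
  classify 1 1 2 _ _ _ _ _ _ ()
  classify 2 2 zero _ _ _ _ _ _ ()
  classify 2 2 1 _ _ _ _ _ _ ()

classify-residues : ∀ a b c → ¬ a ℕ.% 3 ≡ 0 → ¬ b ℕ.% 3 ≡ 0 → ¬ (a ℕ.+ b) ℕ.% 3 ≡ 0 → (a ℕ.+ b ℕ.+ c) ℕ.% 3 ≡ 0 →
                    AllResidues 1 a b c ⊎ AllResidues 2 a b c
classify-residues a b c a≢0 b≢0 a+b≢0 a+b+c≡0 =
  classify (a ℕ.% 3) (b ℕ.% 3) (c ℕ.% 3) (ℕM.m%n<n a 3) (ℕM.m%n<n b 3) (ℕM.m%n<n c 3) a≢0 b≢0
    (λ eq → a+b≢0 (trans (ℕM.%-distribˡ-+ a b 3) eq)) (trans (sym sum%3) a+b+c≡0)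
  where
    sum%3 : (a ℕ.+ b ℕ.+ c) ℕ.% 3 ≡ (a ℕ.% 3 ℕ.+ b ℕ.% 3 ℕ.+ c ℕ.% 3) ℕ.% 3
    sum%3 = begin
      (a ℕ.+ b ℕ.+ c) ℕ.% 3                          ≡⟨ ℕM.%-distribˡ-+ (a ℕ.+ b) c 3 ⟩
      ((a ℕ.+ b) ℕ.% 3 ℕ.+ c ℕ.% 3) ℕ.% 3            ≡⟨ cong (λ z → (z ℕ.+ c ℕ.% 3) ℕ.% 3) (ℕM.%-distribˡ-+ a b 3) ⟩
      ((a ℕ.% 3 ℕ.+ b ℕ.% 3) ℕ.% 3 ℕ.+ c ℕ.% 3) ℕ.% 3 ≡⟨ cong (λ z → ((a ℕ.% 3 ℕ.+ b ℕ.% 3) ℕ.% 3 ℕ.+ z) ℕ.% 3) (ℕM.m%n%n≡m%n c 3) ⟨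
      ((a ℕ.% 3 ℕ.+ b ℕ.% 3) ℕ.% 3 ℕ.+ c ℕ.% 3 ℕ.% 3) ℕ.% 3 ≡⟨ ℕM.%-distribˡ-+ (a ℕ.% 3 ℕ.+ b ℕ.% 3) (c ℕ.% 3) 3 ⟨
      (a ℕ.% 3 ℕ.+ b ℕ.% 3 ℕ.+ c ℕ.% 3) ℕ.% 3        ∎
      where open ≡-Reasoning

-- Closed paths as ℤ-indexed vertex sequences

Step : ℕ → (ℤ → ℤ) → ℤ → ℤ → Set
Step n g x y = ∃[ k ] (x ≡ g k mod n × y ≡ g (k + + 1) mod n)

HasEdgeℤ : ℕ → (ℤ → ℤ) → ℤ → ℤ → Set
HasEdgeℤ n g x y = Step n g x y ⊎ Step n g y x

module _ {n : ℕ} {g h : ℤ → ℤ} where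

  HasEdgeℤ-map : (f : ℤ → ℤ) → (∀ {x y} → Step n g x y → Step n h (f x) (f y)) →
                 ∀ {x y} → HasEdgeℤ n g x y → HasEdgeℤ n h (f x) (f y)
  HasEdgeℤ-map f step (inj₁ s) = inj₁ (step s)
  HasEdgeℤ-map f step (inj₂ s) = inj₂ (step s)

  HasEdgeℤ-mapᵒᵖ : (f : ℤ → ℤ) → (∀ {x y} → Step n g x y → Step n h (f y) (f x)) →
                   ∀ {x y} → HasEdgeℤ n g x y → HasEdgeℤ n h (f x) (f y)
  HasEdgeℤ-mapᵒᵖ f step (inj₁ s) = inj₂ (step s)
  HasEdgeℤ-mapᵒᵖ f step (inj₂ s) = inj₁ (step s)

HasEdgeℤ-swap : ∀ {n g x y} → HasEdgeℤ n g x y → HasEdgeℤ n g y x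
HasEdgeℤ-swap (inj₁ s) = inj₂ s
HasEdgeℤ-swap (inj₂ s) = inj₁ s

HasEdgeℤ-resp : ∀ {n g x x' y y'} → x ≡ x' mod n → y ≡ y' mod n → HasEdgeℤ n g x y → HasEdgeℤ n g x' y'
HasEdgeℤ-resp x≡x' y≡y' (inj₁ (k , p , q)) = inj₁ (k , mod-trans (mod-sym x≡x') p , mod-trans (mod-sym y≡y') q)
HasEdgeℤ-resp x≡x' y≡y' (inj₂ (k , p , q)) = inj₂ (k , mod-trans (mod-sym y≡y') p , mod-trans (mod-sym x≡x') q)

periodic : (n : ℕ) .{{_ : NonZero n}} → (ℕ → ℤ) → ℤ → ℤ
periodic n σ k = σ (k %ℕ n)

module _ (n : ℕ) .{{_ : NonZero n}} (σ : ℕ → ℤ) where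

  private
    τ : ℤ → ℤ
    τ = periodic n σ

    index-below : ∀ {i} → i ℕ.< n → σ i ≡ τ (+ i)
    index-below i<n = cong σ (sym (ℕM.m<n⇒m%n≡m i<n))

    index-next : ∀ {i} → i ℕ.< n → σ (nxt n i) ≡ τ (+ i + + 1)
    index-next {i} i<n = cong σ (sym (trans (%ℕ-+1 n (+ i)) (cong (nxt n) (ℕM.m<n⇒m%n≡m i<n))))

  periodic-cong : ∀ {i j} → i ≡ j mod n → τ i ≡ τ j
  periodic-cong p = cong σ (%ℕ-cong n p)

  HasEdge⇒HasEdgeℤ : ∀ {x y} → HasEdge n σ x y → HasEdgeℤ n τ x y
  HasEdge⇒HasEdgeℤ (i , i<n , inj₁ (p , q)) =
    inj₁ (+ i , mod-trans (Cong⇒mod p) (mod-reflexive (index-below i<n)) ,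
                mod-trans (Cong⇒mod q) (mod-reflexive (index-next i<n)))
  HasEdge⇒HasEdgeℤ (i , i<n , inj₂ (p , q)) =
    inj₂ (+ i , mod-trans (Cong⇒mod q) (mod-reflexive (index-below i<n)) ,
                mod-trans (Cong⇒mod p) (mod-reflexive (index-next i<n)))

  HasEdgeℤ⇒HasEdge : ∀ {x y} → HasEdgeℤ n τ x y → HasEdge n σ x y
  HasEdgeℤ⇒HasEdge (inj₁ (k , p , q)) =
    k %ℕ n , ℤM.n%ℕd<d k n , inj₁ (mod⇒Cong p , mod⇒Cong (mod-trans q (mod-reflexive (cong σ (%ℕ-+1 n k)))))
  HasEdgeℤ⇒HasEdge (inj₂ (k , p , q)) =
    k %ℕ n , ℤM.n%ℕd<d k n , inj₂ (mod⇒Cong (mod-trans q (mod-reflexive (cong σ (%ℕ-+1 n k)))) , mod⇒Cong p)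

  IsPolygon⇒injective : IsPolygon n σ → ∀ {i j} → τ i ≡ τ j mod n → i ≡ j mod n
  IsPolygon⇒injective polygon {i} {j} p =
    mod-trans (%ℕ-mod n i) (mod-trans (mod-reflexive (cong +_ i%n≡j%n)) (mod-sym (%ℕ-mod n j)))
    where i%n≡j%n : i %ℕ n ≡ j %ℕ n
          i%n≡j%n = polygon _ _ (ℤM.n%ℕd<d i n) (ℤM.n%ℕd<d j n) (mod⇒Cong p)

  injective⇒IsPolygon : (∀ {i j} → τ i ≡ τ j mod n → i ≡ j mod n) → IsPolygon n σ
  injective⇒IsPolygon injective i j i<n j<n p = mod⇒≡-below i<n j<n (injective
    (mod-trans (mod-reflexive (sym (index-below i<n))) (mod-trans (Cong⇒mod p) (mod-reflexive (index-below j<n)))))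

Traces : (n : ℕ) → (ℕ → ℤ) → (ℤ → ℤ) → Set
Traces n σ g = ∀ {x y} → HasEdge n σ x y ⇔ HasEdgeℤ n g x y

periodic-traces : ∀ n .{{_ : NonZero n}} σ → Traces n σ (periodic n σ)
periodic-traces n σ = mk⇔ (HasEdge⇒HasEdgeℤ n σ) (HasEdgeℤ⇒HasEdge n σ)

module _ {n : ℕ} {σ σ′ : ℕ → ℤ} {g g′ : ℤ → ℤ} (traces : Traces n σ g) (traces′ : Traces n σ′ g′) {f : ℤ → ℤ} where

  MapsOnto⇒HasEdgeℤ : MapsOnto n f σ σ′ → ∀ {x y} → HasEdgeℤ n g x y → HasEdgeℤ n g′ (f x) (f y)
  MapsOnto⇒HasEdgeℤ maps {x} {y} = Equivalence.to traces′ ∘ Equivalence.to (maps x y) ∘ Equivalence.from traces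

  HasEdgeℤ⇒MapsOnto : (∀ {x y} → HasEdgeℤ n g x y → HasEdgeℤ n g′ (f x) (f y)) →
                      (∀ {x y} → HasEdgeℤ n g′ (f x) (f y) → HasEdgeℤ n g x y) → MapsOnto n f σ σ′
  HasEdgeℤ⇒MapsOnto to from x y =
    mk⇔ (Equivalence.from traces′ ∘ to ∘ Equivalence.to traces) (Equivalence.from traces ∘ from ∘ Equivalence.to traces′)

-- Paths with side pattern (a, b, c, a, b, c, …)

module RegularPaths (m : ℕ) .{{_ : NonZero m}} (a b c : ℕ)
                    (a≡1 : a ℕ.% 3 ≡ 1) (b≡1 : b ℕ.% 3 ≡ 1) (c≡1 : c ℕ.% 3 ≡ 1) where

  n : ℕ
  n = 3 ℕ.* m

  side : ℤ → ℕ
  side = sides3 a b c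

  side≡1 : ∀ k → + side k ≡ + 1 mod 3
  side≡1 k = %3≡⇒mod _ (pick3-all (λ s → s ℕ.% 3 ≡ 1) a≡1 b≡1 c≡1 (k %ℕ 3))

  side-cong : ∀ {k k'} → k ≡ k' mod 3 → side k ≡ side k'
  side-cong p = cong (pick3 a b c) (%ℕ-cong 3 p)

  -- On a path with this side pattern whose position 0 is v_o, the vertex after v_x is v_y.
  record Ahead (o x y : ℤ) : Set where
    constructor ahead
    field step-size : y - x ≡ + side (x - o) mod n

  Ahead-translate : ∀ {o o' t x y} → o + t ≡ o' mod 3 → Ahead o x y → Ahead o' (x + t) (y + t)
  Ahead-translate {o} {o'} {t} {x} {y} o+t≡o' (ahead d) =
    ahead $ mod-trans (mod-reflexive (e x y t)) (mod-trans d (mod-reflexive (cong +_ (side-cong x-o≡))))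
    where
      e : ∀ x y t → (y + t) - (x + t) ≡ y - x
      e = solve-∀
      e′ : ∀ x t o → x - o ≡ (x + t) - (o + t)
      e′ = solve-∀
      x-o≡ : x - o ≡ (x + t) - o' mod 3
      x-o≡ = mod-trans (mod-reflexive (e′ x t o)) (+-cong-mod (mod-refl {x = x + t}) (-‿cong-mod o+t≡o'))

  Ahead⇒difference≡1 : ∀ {o x y} → Ahead o x y → y - x ≡ + 1 mod 3
  Ahead⇒difference≡1 {o} {x} (ahead d) = mod-trans (mod-divisor (ℕD.m∣m*n m) d) (side≡1 (x - o))

  ¬Ahead-backwards : ∀ {o x y} → y - x ≡ + 1 mod 3 → ¬ Ahead o y x
  ¬Ahead-backwards {o} {x} {y} forward backward = 0≢2 (%ℕ-cong 3 (mod-trans (mod-reflexive (e x y))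
      (+-cong-mod forward (Ahead⇒difference≡1 backward))))
    where
      e : ∀ x y → + 0 ≡ (y - x) + (x - y)
      e = solve-∀
      0≢2 : ¬ (+ 0) %ℕ 3 ≡ (+ 1 + + 1) %ℕ 3
      0≢2 ()

  mirror : ℕ → ℤ → ℤ
  mirror q o = + q + (o + o)

  Ahead-reflect : ∀ q → (∀ k → side k ≡ side (+ q - k - + 1)) →
                  ∀ {o x y} → Ahead o x y → Ahead o (mirror q o - y) (mirror q o - x)
  Ahead-reflect q symmetric-pattern {o} {x} {y} a@(ahead d) =
    ahead $ mod-trans (mod-reflexive (e r x y)) (mod-trans d (mod-reflexive (cong +_ side-same)))
    where
      r : ℤ
      r = mirror q o
      e : ∀ r x y → (r - x) - (r - y) ≡ y - x
      e = solve-∀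
      e′ : ∀ q x o y → q - (x - o) - + 1 ≡ ((q + (o + o)) - y) - o + (y - (x + + 1))
      e′ = solve-∀
      y≡x+1 : y - (x + + 1) ≡ + 0 mod 3
      y≡x+1 = mod-trans (mod-reflexive (e″ x y)) (+-cong-mod (Ahead⇒difference≡1 a) (mod-refl {x = - + 1}))
        where e″ : ∀ x y → y - (x + + 1) ≡ (y - x) + - + 1
              e″ = solve-∀
      side-same : side (x - o) ≡ side ((r - y) - o)
      side-same = trans (symmetric-pattern (x - o)) (side-cong (mod-trans (mod-reflexive (e′ (+ q) x o y))
        (mod-trans (+-cong-mod (mod-refl {x = (r - y) - o}) y≡x+1) (mod-reflexive (ℤP.+-identityʳ ((r - y) - o))))))

  palindromic : ∀ q → (∀ r → r ℕ.< 3 → pick3 a b c r ≡ side (+ q - + r - + 1)) →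
                ∀ k → side k ≡ side (+ q - k - + 1)
  palindromic q on-residues k = trans (on-residues (k %ℕ 3) (ℤM.n%ℕd<d k 3))
    (side-cong (+-cong-mod (+-cong-mod (mod-refl {x = + q}) (-‿cong-mod (mod-sym (%ℕ-mod 3 k)))) mod-refl))

  side-sum : ∀ k → + side k + + side (k + + 1) + + side (k + + 1 + + 1) ≡ + (a ℕ.+ b ℕ.+ c)
  side-sum k = begin
    + side k + + side (k + + 1) + + side (k + + 1 + + 1)
      ≡⟨ cong₂ (λ i j → + pick3 a b c (k %ℕ 3) + + pick3 a b c i + + pick3 a b c j) r₁ r₂ ⟩
    + pick3 a b c r + + pick3 a b c (nxt 3 r) + + pick3 a b c (nxt 3 (nxt 3 r))
      ≡⟨ cong (_+ + pick3 a b c (nxt 3 (nxt 3 r))) (ℤP.pos-+ (pick3 a b c r) _) ⟨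
    + (pick3 a b c r ℕ.+ pick3 a b c (nxt 3 r)) + + pick3 a b c (nxt 3 (nxt 3 r))
      ≡⟨ ℤP.pos-+ (pick3 a b c r ℕ.+ _) _ ⟨
    + (pick3 a b c r ℕ.+ pick3 a b c (nxt 3 r) ℕ.+ pick3 a b c (nxt 3 (nxt 3 r)))
      ≡⟨ cong +_ (pick3-consecutive-sum a b c r (ℤM.n%ℕd<d k 3)) ⟩
    + (a ℕ.+ b ℕ.+ c) ∎
    where
      open ≡-Reasoning
      r : ℕ
      r = k %ℕ 3
      r₁ : (k + + 1) %ℕ 3 ≡ nxt 3 r
      r₁ = %ℕ-+1 3 k
      r₂ : (k + + 1 + + 1) %ℕ 3 ≡ nxt 3 (nxt 3 r)
      r₂ = trans (%ℕ-+1 3 (k + + 1)) (cong (nxt 3) r₁)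

  module Path (u : ℕ) (a+b+c≡3u : a ℕ.+ b ℕ.+ c ≡ 3 ℕ.* u) (w : ℤ) (uw≡1 : + u * w ≡ + 1 mod m)
              (g : ℤ → ℤ) (g-step : ∀ k → g (k + + 1) ≡ g k + + side k mod n) where

    private
      open mod-Reasoning n

      3u : ℤ
      3u = + 3 * + u

      u-cancel : ∀ {q} → + u * q ≡ + 0 mod m → q ≡ + 0 mod m
      u-cancel {q} uq≡0 = mod-trans (mod-sym (mod-trans (*-congˡ-mod q uw≡1) (mod-reflexive (ℤP.*-identityʳ q))))
        (mod-trans (mod-reflexive (e w (+ u) q)) (mod-trans (*-congˡ-mod w uq≡0) (mod-reflexive (ℤP.*-zeroʳ w))))
        where e : ∀ w u q → q * (u * w) ≡ w * (u * q)
              e = solve-∀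

    step3 : ∀ k → g (k + + 3) ≡ g k + 3u mod n
    step3 k = begin
      g (k + + 3)                                                   ≡⟨ cong g (e k) ⟩
      g (k + + 1 + + 1 + + 1)                                       ≈⟨ g-step _ ⟩
      g (k + + 1 + + 1) + + side (k + + 1 + + 1)                     ≈⟨ +-cong-mod (g-step _) mod-refl ⟩
      g (k + + 1) + + side (k + + 1) + + side (k + + 1 + + 1)        ≈⟨ +-cong-mod (+-cong-mod (g-step _) mod-refl) mod-refl ⟩
      g k + + side k + + side (k + + 1) + + side (k + + 1 + + 1)     ≡⟨ e′ (g k) (+ side k) _ _ ⟩
      g k + (+ side k + + side (k + + 1) + + side (k + + 1 + + 1))   ≡⟨ cong (λ s → g k + s) (side-sum k) ⟩
      g k + + (a ℕ.+ b ℕ.+ c)                                       ≡⟨ cong (λ s → g k + + s) a+b+c≡3u ⟩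
      g k + + (3 ℕ.* u)                                             ≡⟨ cong (λ s → g k + s) (ℤP.pos-* 3 u) ⟩
      g k + 3u                                                      ∎
      where e : ∀ k → k + + 3 ≡ k + + 1 + + 1 + + 1
            e = solve-∀
            e′ : ∀ x p q r → x + p + q + r ≡ x + (p + q + r)
            e′ = solve-∀

    iterate : ∀ k s → g (k + + 3 * s) ≡ g k + 3u * s mod n
    iterate = iterate-shift g (+ 3) 3u step3

    index≡mod3 : ∀ k → g k - g (+ 0) ≡ k mod 3
    index≡mod3 = ℤ-induction P (mod-reflexive (ℤP.+-inverseʳ (g (+ 0)))) up down
      where
        P : ℤ → Set
        P k = g k - g (+ 0) ≡ k mod 3
        step : ∀ k → g (k + + 1) - g (+ 0) ≡ (g k - g (+ 0)) + + 1 mod 3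
        step k = mod-trans (+-cong-mod (mod-divisor (ℕD.m∣m*n m) (g-step k)) mod-refl)
          (mod-trans (mod-reflexive (e (g k) (g (+ 0)) (+ side k))) (+-cong-mod (mod-refl {x = g k - g (+ 0)}) (side≡1 k)))
          where e : ∀ x y s → (x + s) - y ≡ (x - y) + s
                e = solve-∀
        up : ∀ k → P k → P (k + + 1)
        up k p = mod-trans (step k) (+-cong-mod p mod-refl)
        down : ∀ k → P (k + + 1) → P k
        down k p = +-cancelʳ-mod (mod-trans (mod-sym (step k)) p)

    injective : ∀ {i j} → g i ≡ g j mod n → i ≡ j mod n
    injective {i} {j} gi≡gj = mod-trans (mod-reflexive i≡j+3q) (mod-trans (+-cong-mod (mod-refl {x = j}) 3q≡0)
                                        (mod-reflexive (ℤP.+-identityʳ j)))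
      where
        i≡j : i ≡ j mod 3
        i≡j = mod-trans (mod-sym (index≡mod3 i))
                (mod-trans (+-cong-mod (mod-divisor (ℕD.m∣m*n m) gi≡gj) mod-refl) (index≡mod3 j))
        q : ℤ
        q = proj₁ (mod-quotient i≡j)
        i≡j+3q : i ≡ j + + 3 * q
        i≡j+3q = trans (proj₂ (mod-quotient i≡j)) (cong (λ s → j + s) (ℤP.*-comm q (+ 3)))
        3uq≡0 : + 3 * (+ u * q) ≡ + 3 * + 0 mod n
        3uq≡0 = +-cancelˡ-mod {z = g j} (begin
          g j + + 3 * (+ u * q)  ≡⟨ cong (λ s → g j + s) (ℤP.*-assoc (+ 3) (+ u) q) ⟨
          g j + 3u * q           ≈⟨ mod-sym (iterate j q) ⟩
          g (j + + 3 * q)        ≡⟨ cong g i≡j+3q ⟨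
          g i                    ≈⟨ gi≡gj ⟩
          g j                    ≡⟨ ℤP.+-identityʳ (g j) ⟨
          g j + + 3 * + 0        ∎)
        3q≡0 : + 3 * q ≡ + 0 mod n
        3q≡0 = *-cong-modulus 3 (u-cancel (*-cancel-modulus 3 3uq≡0))

    surjective : ∀ x → ∃[ k ] x ≡ g k mod n
    surjective x = k₀ + + 3 * (t * w) , (begin
      x                             ≡⟨ x≡gk₀+3t ⟩
      g k₀ + + 3 * t                ≈⟨ +-cong-mod (mod-refl {x = g k₀}) (mod-sym 3utw≡3t) ⟩
      g k₀ + 3u * (t * w)           ≈⟨ mod-sym (iterate k₀ (t * w)) ⟩
      g (k₀ + + 3 * (t * w))        ∎)
      where
        k₀ : ℤ
        k₀ = x - g (+ 0)
        x≡gk₀ : x - g k₀ ≡ + 0 mod 3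
        x≡gk₀ = mod-trans (mod-reflexive (e x (g (+ 0)) (g k₀)))
                  (mod-trans (+-cong-mod (mod-refl {x = k₀}) (-‿cong-mod (index≡mod3 k₀))) (mod-reflexive (ℤP.+-inverseʳ k₀)))
          where e : ∀ x g₀ gk → x - gk ≡ (x - g₀) + - (gk - g₀)
                e = solve-∀
        t : ℤ
        t = proj₁ (mod-quotient x≡gk₀)
        x≡gk₀+3t : x ≡ g k₀ + + 3 * t
        x≡gk₀+3t = e x (g k₀) t (proj₂ (mod-quotient x≡gk₀))
          where e : ∀ x y t → x - y ≡ + 0 + t * + 3 → x ≡ y + + 3 * t
                e x y t eq = trans (e′ x y) (cong (λ s → y + s) (trans eq (e″ t)))
                  where e′ : ∀ x y → x ≡ y + (x - y)
                        e′ = solve-∀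
                        e″ : ∀ t → + 0 + t * + 3 ≡ + 3 * t
                        e″ = solve-∀
        3utw≡3t : 3u * (t * w) ≡ + 3 * t mod n
        3utw≡3t = mod-trans (mod-reflexive (e t (+ u) w))
          (mod-trans (*-cong-modulus 3 (*-congˡ-mod t uw≡1)) (mod-reflexive (cong (+ 3 *_) (ℤP.*-identityʳ t))))
          where e : ∀ t u w → + 3 * u * (t * w) ≡ + 3 * (t * (u * w))
                e = solve-∀

    vertex≡index : ∀ {x k} → x ≡ g k mod n → x - g (+ 0) ≡ k mod 3
    vertex≡index {x} {k} x≡gk = mod-trans (+-cong-mod (mod-divisor (ℕD.m∣m*n m) x≡gk) mod-refl) (index≡mod3 k)

    Step⇒Ahead : ∀ {x y} → Step n g x y → Ahead (g (+ 0)) x y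
    Step⇒Ahead {x} {y} (k , x≡gk , y≡gk+1) = ahead $ mod-trans (+-cong-mod (mod-trans y≡gk+1 (g-step k)) (-‿cong-mod x≡gk))
      (mod-reflexive (trans (e (g k) (+ side k)) (cong +_ (side-cong (mod-sym (vertex≡index x≡gk))))))
      where e : ∀ x s → x + s - x ≡ s
            e = solve-∀

    Ahead⇒Step : ∀ {x y} → Ahead (g (+ 0)) x y → Step n g x y
    Ahead⇒Step {x} {y} (ahead d) = from (surjective x)
      where
        e : ∀ y x → y ≡ x + (y - x)
        e = solve-∀
        from : ∃[ k ] x ≡ g k mod n → Step n g x y
        from (k , x≡gk) = k , x≡gk , (begin
          y                                ≡⟨ e y x ⟩
          x + (y - x)                      ≈⟨ +-cong-mod x≡gk d ⟩
          g k + + side (x - g (+ 0))       ≡⟨ cong (λ s → g k + + s) (side-cong (vertex≡index x≡gk)) ⟩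
          g k + + side k                   ≈⟨ mod-sym (g-step k) ⟩
          g (k + + 1)                      ∎)

    rotate : ∀ {t} → t ≡ + 0 mod 3 → ∀ {x y} → HasEdgeℤ n g x y → HasEdgeℤ n g (x + t) (y + t)
    rotate {t} t≡0 = HasEdgeℤ-map (_+ t) (λ s → Ahead⇒Step (Ahead-translate g₀+t≡g₀ (Step⇒Ahead s)))
      where g₀+t≡g₀ : g (+ 0) + t ≡ g (+ 0) mod 3
            g₀+t≡g₀ = mod-trans (+-cong-mod (mod-refl {x = g (+ 0)}) t≡0) (mod-reflexive (ℤP.+-identityʳ (g (+ 0))))

    rotate⁻¹ : ∀ {t} → t ≡ + 0 mod 3 → ∀ {x y} → HasEdgeℤ n g (x + t) (y + t) → HasEdgeℤ n g x y
    rotate⁻¹ {t} t≡0 {x} {y} edge =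
      HasEdgeℤ-resp (mod-reflexive (e x t)) (mod-reflexive (e y t)) (rotate -t≡0 edge)
      where e : ∀ x t → x + t + - t ≡ x
            e = solve-∀
            -t≡0 : - t ≡ + 0 mod 3
            -t≡0 = -‿cong-mod t≡0

    reflect : ∀ q → (∀ k → side k ≡ side (+ q - k - + 1)) →
              ∀ {x y} → HasEdgeℤ n g x y → HasEdgeℤ n g (mirror q (g (+ 0)) - x) (mirror q (g (+ 0)) - y)
    reflect q symmetric-pattern = HasEdgeℤ-mapᵒᵖ (λ x → mirror q (g (+ 0)) - x)
      (λ s → Ahead⇒Step (Ahead-reflect q symmetric-pattern (Step⇒Ahead s)))

    b-edge : HasEdgeℤ n g (g (+ 0) + + 1) (g (+ 0) + + 1 + + b)
    b-edge = inj₁ (Ahead⇒Step (ahead $ mod-reflexive (trans (e (g (+ 0) + + 1) (+ b)) (cong (λ k → + side k) (e′ (g (+ 0)))))))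
      where e : ∀ x b → (x + b) - x ≡ b
            e = solve-∀
            e′ : ∀ g₀ → + 1 ≡ (g₀ + + 1) - g₀
            e′ = solve-∀

    a-edge : HasEdgeℤ n g (g (+ 0) + + 1 - + a) (g (+ 0) + + 1)
    a-edge = inj₁ (Ahead⇒Step (ahead $ mod-trans (mod-reflexive (e (g (+ 0) + + 1) (+ a)))
                     (mod-reflexive (cong +_ (side-cong (mod-sym x-a-g₀≡0))))))
      where e : ∀ x a → x - (x - a) ≡ a
            e = solve-∀
            e′ : ∀ g₀ a → (g₀ + + 1 - a) - g₀ ≡ + 1 - a
            e′ = solve-∀
            x-a-g₀≡0 : (g (+ 0) + + 1 - + a) - g (+ 0) ≡ + 0 mod 3
            x-a-g₀≡0 = mod-trans (mod-reflexive (e′ (g (+ 0)) (+ a)))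
              (+-cong-mod (mod-refl {x = + 1}) (-‿cong-mod (%3≡⇒mod a a≡1)))

    module _ (a<n : a ℕ.< n) (b<n : b ℕ.< n) (c<n : c ℕ.< n) where

      private
        g₀ : ℤ
        g₀ = g (+ 0)

        oriented : ∀ {x p} → p ℕ.% 3 ≡ 1 → HasEdgeℤ n g x (x + + p) → Ahead g₀ x (x + + p)
        oriented p≡1 (inj₁ s) = Step⇒Ahead s
        oriented {x} {p} p≡1 (inj₂ s) = ⊥-elim (¬Ahead-backwards forward (Step⇒Ahead s))
          where e : ∀ x p → (x + p) - x ≡ p
                e = solve-∀
                forward : (x + + p) - x ≡ + 1 mod 3
                forward = mod-trans (mod-reflexive (e x (+ p))) (%3≡⇒mod p p≡1)

        side-of-edge : ∀ {x p} → p ℕ.% 3 ≡ 1 → p ℕ.< n → HasEdgeℤ n g x (x + + p) → p ≡ side (x - g₀)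
        side-of-edge {x} {p} p≡1 p<n edge = mod⇒≡-below p<n (pick3-all (ℕ._< n) a<n b<n c<n _)
          (mod-trans (mod-reflexive (e x (+ p))) (Ahead.step-size (oriented p≡1 edge)))
          where e : ∀ x p → p ≡ (x + p) - x
                e = solve-∀

      -- The reflection turns the consecutive sides a, b around v_(g 0 + 1) into consecutive
      -- sides b, a of the pattern.
      axis⇒equal-sides : ∀ r → (∀ x y → HasEdgeℤ n g x y → HasEdgeℤ n g (r - x) (r - y)) →
                         a ≡ b ⊎ b ≡ c ⊎ c ≡ a
      axis⇒equal-sides r symmetric = by-residue (residue3 Z)
        where
          x z Z : ℤ
          x = g₀ + + 1
          z = r - x
          Z = z - g₀
          b≡ : b ≡ side ((z - + b) - g₀)
          b≡ = side-of-edge b≡1 b<n (HasEdgeℤ-resp (mod-reflexive (e r x (+ b))) (mod-reflexive (e′ r x (+ b)))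
                 (HasEdgeℤ-swap (symmetric _ _ b-edge)))
            where e : ∀ r x b → r - (x + b) ≡ (r - x) - b
                  e = solve-∀
                  e′ : ∀ r x b → r - x ≡ ((r - x) - b) + b
                  e′ = solve-∀
          a≡ : a ≡ side Z
          a≡ = side-of-edge a≡1 a<n (HasEdgeℤ-resp mod-refl (mod-reflexive (e r x (+ a)))
                 (HasEdgeℤ-swap (symmetric _ _ a-edge)))
            where e : ∀ r x a → r - (x - a) ≡ (r - x) + a
                  e = solve-∀
          Z-b≡ : ∀ {ρ} → Z %ℕ 3 ≡ ρ → (z - + b) - g₀ ≡ + ρ - + 1 mod 3
          Z-b≡ {ρ} eq = mod-trans (mod-reflexive (e z (+ b) g₀))
            (+-cong-mod (mod-trans (%ℕ-mod 3 Z) (mod-reflexive (cong +_ eq))) (-‿cong-mod (%3≡⇒mod b b≡1)))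
            where e : ∀ z b g₀ → (z - b) - g₀ ≡ (z - g₀) - b
                  e = solve-∀
          by-residue : Z %ℕ 3 ≡ 0 ⊎ Z %ℕ 3 ≡ 1 ⊎ Z %ℕ 3 ≡ 2 → a ≡ b ⊎ b ≡ c ⊎ c ≡ a
          by-residue (inj₁ eq)        = inj₂ (inj₁ (trans b≡ (side-cong (Z-b≡ eq))))
          by-residue (inj₂ (inj₁ eq)) = inj₁ (trans a≡ (cong (pick3 a b c) eq))
          by-residue (inj₂ (inj₂ eq)) = inj₂ (inj₂ (sym (trans a≡ (cong (pick3 a b c) eq))))

-- Polygons invariant under the rotation through 3

ℤ⁺-induction₂ : (P : ℤ → Set) → P (+ 0) → P (+ 1) → (∀ k → P k → P (k + + 1) → P (k + + 1 + + 1)) →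
                ∀ j → P (+ j)
ℤ⁺-induction₂ P p₀ p₁ step j = proj₁ (pairs j)
  where
    pairs : ∀ j → P (+ j) × P (+ suc j)
    pairs zero    = p₀ , p₁
    pairs (suc j) with pairs j
    ... | p , q = q , subst P (cong +_ (trans (ℕP.+-assoc j 1 1) (ℕP.+-comm j 2)))
                            (step (+ j) p (subst P (cong +_ (ℕP.+-comm 1 j)) q))

module IndexedPolygon (n : ℕ) .{{_ : NonZero n}} (g : ℤ → ℤ)
                    (g-periodic : ∀ {i j} → i ≡ j mod n → g i ≡ g j)
                    (g-injective : ∀ {i j} → g i ≡ g j mod n → i ≡ j mod n) where

  neighbour : ∀ {j y} → HasEdgeℤ n g (g j) y → y ≡ g (j + + 1) mod n ⊎ y ≡ g (j - + 1) mod n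
  neighbour {j} (inj₁ (k , gj≡gk , y≡gk+1)) =
    inj₁ (mod-trans y≡gk+1 (mod-reflexive (g-periodic (+-cong-mod (mod-sym (g-injective gj≡gk)) mod-refl))))
  neighbour {j} (inj₂ (k , y≡gk , gj≡gk+1)) =
    inj₂ (mod-trans y≡gk (mod-reflexive (g-periodic (mod-trans (mod-reflexive (e k))
           (+-cong-mod (mod-sym (g-injective gj≡gk+1)) mod-refl)))))
    where e : ∀ k → k ≡ (k + + 1) - + 1
          e = solve-∀

  nonzero-below : ∀ {s} → 0 ℕ.< s → s ℕ.< n → ¬ + s ≡ + 0 mod n
  nonzero-below 0<s s<n s≡0 with mod⇒≡-below s<n (ℕ.>-nonZero⁻¹ n) s≡0
  ... | refl = ℕP.<-irrefl refl 0<s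

  distinct : ∀ {s k} → 0 ℕ.< s → s ℕ.< n → ¬ g (k + + s) ≡ g k mod n
  distinct {s} {k} 0<s s<n gk+s≡gk = nonzero-below 0<s s<n
    (+-cancelˡ-mod {z = k} (mod-trans (g-injective gk+s≡gk) (mod-reflexive (sym (ℤP.+-identityʳ k)))))

  extend-from-ℕ : (P : ℤ → Set) → (∀ {k k'} → k ≡ k' mod n → P k' → P k) → (∀ j → P (+ j)) → ∀ k → P k
  extend-from-ℕ P resp p k = resp (%ℕ-mod n k) (p (k %ℕ n))

  module _ (6<n : 6 ℕ.< n) (invariant : ∀ x y → HasEdgeℤ n g x y → HasEdgeℤ n g (x + + 3) (y + + 3)) where

    private
      2<n : 2 ℕ.< n
      2<n = ℕP.<-trans (s≤s (s≤s (s≤s z≤n))) 6<n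

      image : ∀ k → HasEdgeℤ n g (g (k + + 1) + + 3) (g (k + + 1 + + 1) + + 3)
      image k = invariant _ _ (inj₁ (k + + 1 , mod-refl , mod-refl))

      ¬two-apart : ∀ {k} → g (k + + 1 + + 1) + + 3 ≡ g k + + 3 mod n → ⊥
      ¬two-apart {k} p = distinct {2} {k} (s≤s z≤n) 2<n
        (mod-trans (mod-reflexive (cong g (e k))) (+-cancelʳ-mod p))
        where e : ∀ k → k + + 2 ≡ k + + 1 + + 1
              e = solve-∀

    module Forward (i : ℤ) (p₀ : g (+ 0) + + 3 ≡ g i mod n) (p₁ : g (+ 1) + + 3 ≡ g (i + + 1) mod n) where

      Shifted : ℤ → Set
      Shifted k = g (k + i) ≡ g k + + 3 mod n

      step : ∀ k → Shifted k → Shifted (k + + 1) → Shifted (k + + 1 + + 1)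
      step k sₖ sₖ₊₁ with neighbour (HasEdgeℤ-resp (mod-sym sₖ₊₁) mod-refl (image k))
      ... | inj₁ next = mod-sym (mod-trans next (mod-reflexive (cong g (e k i))))
        where e : ∀ k i → (k + + 1 + i) + + 1 ≡ (k + + 1 + + 1) + i
              e = solve-∀
      ... | inj₂ prev = ⊥-elim (¬two-apart (mod-trans prev (mod-trans (mod-reflexive (cong g (e k i))) sₖ)))
        where e : ∀ k i → (k + + 1 + i) - + 1 ≡ k + i
              e = solve-∀

      shifted : ∀ k → Shifted k
      shifted = extend-from-ℕ Shifted
        (λ k≡k' s → mod-trans (mod-reflexive (g-periodic (+-cong-mod k≡k' mod-refl)))
                              (mod-trans s (+-cong-mod (mod-reflexive (g-periodic (mod-sym k≡k'))) mod-refl)))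
        (ℤ⁺-induction₂ Shifted (mod-sym (mod-trans p₀ (mod-reflexive (cong g (sym (ℤP.+-identityˡ i))))))
                               (mod-sym (mod-trans p₁ (mod-reflexive (cong g (ℤP.+-comm i (+ 1))))))
                               step)

    -- An index reversal k ↦ c − k would make the rotation through 3 an involution.
    module Backward (i : ℤ) (p₀ : g (+ 0) + + 3 ≡ g (i + + 1) mod n) (p₁ : g (+ 1) + + 3 ≡ g i mod n) where

      c : ℤ
      c = i + + 1

      Mirrored : ℤ → Set
      Mirrored k = g (c - k) ≡ g k + + 3 mod n

      step : ∀ k → Mirrored k → Mirrored (k + + 1) → Mirrored (k + + 1 + + 1)
      step k mₖ mₖ₊₁ with neighbour (HasEdgeℤ-resp (mod-sym mₖ₊₁) mod-refl (image k))
      ... | inj₁ next = ⊥-elim (¬two-apart (mod-trans next (mod-trans (mod-reflexive (cong g (e c k))) mₖ)))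
        where e : ∀ c k → (c - (k + + 1)) + + 1 ≡ c - k
              e = solve-∀
      ... | inj₂ prev = mod-sym (mod-trans prev (mod-reflexive (cong g (e c k))))
        where e : ∀ c k → (c - (k + + 1)) - + 1 ≡ c - (k + + 1 + + 1)
              e = solve-∀

      mirrored : ∀ k → Mirrored k
      mirrored = extend-from-ℕ Mirrored
        (λ k≡k' m → mod-trans (mod-reflexive (g-periodic (+-cong-mod (mod-refl {x = c}) (-‿cong-mod k≡k'))))
                              (mod-trans m (+-cong-mod (mod-reflexive (g-periodic (mod-sym k≡k'))) mod-refl)))
        (ℤ⁺-induction₂ Mirrored (mod-sym (mod-trans p₀ (mod-reflexive (cong g (sym (ℤP.+-identityʳ c))))))
                                (mod-sym (mod-trans p₁ (mod-reflexive (cong g (e i)))))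
                                step)
        where e : ∀ i → i ≡ (i + + 1) - + 1
              e = solve-∀

      impossible : ⊥
      impossible = nonzero-below {6} (s≤s z≤n) 6<n (+-cancelˡ-mod {z = g (+ 0)} (begin
        g (+ 0) + + 6            ≡⟨ e (g (+ 0)) ⟩
        (g (+ 0) + + 3) + + 3    ≈⟨ +-cong-mod (mod-trans (mod-sym (mirrored (+ 0))) (mod-reflexive (cong g (e′ c)))) mod-refl ⟩
        g c + + 3                ≈⟨ mod-sym (mirrored c) ⟩
        g (c - c)                ≡⟨ cong g (ℤP.+-inverseʳ c) ⟩
        g (+ 0)                  ≡⟨ ℤP.+-identityʳ (g (+ 0)) ⟨
        g (+ 0) + + 0            ∎))
        where
          open mod-Reasoning n
          e : ∀ x → x + + 6 ≡ (x + + 3) + + 3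
          e = solve-∀
          e′ : ∀ c → c - + 0 ≡ c
          e′ = solve-∀

    rotation⇒shift : ∃[ d ] ∀ k → g (k + + d) ≡ g k + + 3 mod n
    rotation⇒shift with invariant _ _ (inj₁ (+ 0 , mod-refl , mod-refl))
    ... | inj₁ (i , p₀ , p₁) = i %ℕ n , λ k →
      mod-trans (mod-reflexive (g-periodic (+-cong-mod (mod-refl {x = k}) (mod-sym (%ℕ-mod n i))))) (Forward.shifted i p₀ p₁ k)
    ... | inj₂ (i , p₁ , p₀) = ⊥-elim (Backward.impossible i p₀ p₁)

record PeriodicSides (m : ℕ) (g : ℤ → ℤ) : Set where
  field
    a b c         : ℕ
    a<n           : a ℕ.< 3 ℕ.* m
    b<n           : b ℕ.< 3 ℕ.* m
    c<n           : c ℕ.< 3 ℕ.* m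
    g-step        : ∀ k → g (k + + 1) ≡ g k + + sides3 a b c k mod 3 ℕ.* m
    residues      : AllResidues 1 a b c ⊎ AllResidues 2 a b c
    u             : ℕ
    a+b+c≡3u      : a ℕ.+ b ℕ.+ c ≡ 3 ℕ.* u
    w             : ℤ
    uw≡1          : + u * w ≡ + 1 mod m

module ShiftedPolygon (m : ℕ) .{{_ : NonZero m}} (g : ℤ → ℤ)
                      (g-periodic : ∀ {i j} → i ≡ j mod 3 ℕ.* m → g i ≡ g j)
                      (g-injective : ∀ {i j} → g i ≡ g j mod 3 ℕ.* m → i ≡ j mod 3 ℕ.* m)
                      (d : ℕ) (shift : ∀ k → g (k + + d) ≡ g k + + 3 mod 3 ℕ.* m) where

  n : ℕ
  n = 3 ℕ.* m

  private
    orbit : ∀ s → g (+ 0 + + d * + s) ≡ g (+ 0) + + 3 * + s mod n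
    orbit = iterate-shift g (+ d) (+ 3) shift (+ 0) ∘ +_

    as-product : ∀ x y → + (x ℕ.* y) ≡ + x * + y mod n
    as-product x y = mod-reflexive (ℤP.pos-* x y)

  n∣3s⇒n∣ds : ∀ s → n ℕD.∣ 3 ℕ.* s → n ℕD.∣ d ℕ.* s
  n∣3s⇒n∣ds s n∣3s = ≡0-mod⇒∣ (begin
    + (d ℕ.* s)                 ≈⟨ as-product d s ⟩
    + d * + s                   ≡⟨ ℤP.+-identityˡ (+ d * + s) ⟨
    + 0 + + d * + s             ≈⟨ g-injective (begin
      g (+ 0 + + d * + s)           ≈⟨ orbit s ⟩
      g (+ 0) + + 3 * + s           ≈⟨ +-cong-mod (mod-refl {x = g (+ 0)}) (mod-trans (mod-sym (as-product 3 s)) (∣⇒≡0-mod n∣3s)) ⟩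
      g (+ 0) + + 0                 ≡⟨ ℤP.+-identityʳ (g (+ 0)) ⟩
      g (+ 0 + + 0)                 ∎) ⟩
    + 0 + + 0                   ∎)
    where open mod-Reasoning n

  n∣ds⇒n∣3s : ∀ s → n ℕD.∣ d ℕ.* s → n ℕD.∣ 3 ℕ.* s
  n∣ds⇒n∣3s s n∣ds = ≡0-mod⇒∣ (+-cancelˡ-mod {z = g (+ 0)} (begin
    g (+ 0) + + (3 ℕ.* s)       ≈⟨ +-cong-mod (mod-refl {x = g (+ 0)}) (as-product 3 s) ⟩
    g (+ 0) + + 3 * + s         ≈⟨ mod-sym (orbit s) ⟩
    g (+ 0 + + d * + s)         ≡⟨ g-periodic (+-cong-mod (mod-refl {x = + 0}) (mod-trans (mod-sym (as-product d s)) (∣⇒≡0-mod n∣ds))) ⟩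
    g (+ 0)                     ≡⟨ ℤP.+-identityʳ (g (+ 0)) ⟨
    g (+ 0) + + 0               ∎))
    where open mod-Reasoning n

  3∣d : 3 ℕD.∣ d
  3∣d = ℕD.*-cancelʳ-∣ m (n∣3s⇒n∣ds m ℕD.∣-refl)

  t : ℕ
  t = ℕD.quotient 3∣d

  d≡t*3 : d ≡ t ℕ.* 3
  d≡t*3 = ℕD.m∣n⇒n≡quotient*m 3∣d

  -- If e divides t and m = m′ e, then n divides d m′, hence 3 m′, so m′ = m.
  t-coprime : Coprime t m
  t-coprime {e} (e∣t , e∣m) = ℕP.*-cancelˡ-≡ e 1 m′ {{ℕD.quotient≢0 e∣m}} (begin
    m′ ℕ.* e   ≡⟨ ℕD.m∣n⇒n≡quotient*m e∣m ⟨
    m          ≡⟨ ℕD.∣-antisym m∣m′ (ℕD.quotient-∣ e∣m) ⟩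
    m′         ≡⟨ ℕP.*-identityʳ m′ ⟨
    m′ ℕ.* 1   ∎)
    where
      open ≡-Reasoning
      m′ t′ : ℕ
      m′ = ℕD.quotient e∣m
      t′ = ℕD.quotient e∣t
      dm′≡t′n : d ℕ.* m′ ≡ t′ ℕ.* n
      dm′≡t′n = begin
        d ℕ.* m′                        ≡⟨ cong (ℕ._* m′) (trans d≡t*3 (cong (ℕ._* 3) (ℕD.m∣n⇒n≡quotient*m e∣t))) ⟩
        t′ ℕ.* e ℕ.* 3 ℕ.* m′           ≡⟨ e′ t′ e m′ ⟩
        t′ ℕ.* (3 ℕ.* (m′ ℕ.* e))       ≡⟨ cong (λ z → t′ ℕ.* (3 ℕ.* z)) (ℕD.m∣n⇒n≡quotient*m e∣m) ⟨
        t′ ℕ.* n                        ∎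
        where e′ : ∀ t′ e m′ → t′ ℕ.* e ℕ.* 3 ℕ.* m′ ≡ t′ ℕ.* (3 ℕ.* (m′ ℕ.* e))
              e′ = ℕSolver.solve-∀
      m∣m′ : m ℕD.∣ m′
      m∣m′ = ℕD.*-cancelˡ-∣ 3 (n∣ds⇒n∣3s m′ (ℕD.divides t′ dm′≡t′n))

  v : ℤ
  v = proj₁ (coprime⇒inverse t-coprime)

  tv≡1 : + t * v ≡ + 1 mod m
  tv≡1 = proj₂ (coprime⇒inverse t-coprime)

  step3 : ∀ k → g (k + + 3) ≡ g k + + 3 * v mod n
  step3 k = begin
    g (k + + 3)          ≡⟨ g-periodic (+-cong-mod (mod-refl {x = k}) 3≡dv) ⟩
    g (k + + d * v)      ≈⟨ iterate-shift g (+ d) (+ 3) shift k v ⟩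
    g k + + 3 * v        ∎
    where
      open mod-Reasoning n
      e : ∀ t v → t * + 3 * v ≡ + 3 * (t * v)
      e = solve-∀
      3≡dv : + 3 ≡ + d * v mod n
      3≡dv = mod-sym (mod-trans (mod-reflexive (trans (cong (λ z → + z * v) d≡t*3)
                                                     (trans (cong (_* v) (ℤP.pos-* t 3)) (e (+ t) v))))
                                (*-cong-modulus 3 tv≡1))

  iterate3 : ∀ k q → g (k + + 3 * q) ≡ g k + (+ 3 * v) * q mod n
  iterate3 = iterate-shift g (+ 3) (+ 3 * v) step3

  same-class : ∀ {i j} → g j ≡ g i mod 3 → j ≡ i mod 3
  same-class {i} {j} gj≡gi = mod-trans (mod-sym (mod-divisor (ℕD.m∣m*n m) i+3zt≡j))
    (mod-trans (+-cong-mod (mod-refl {x = i}) (mod-trans (mod-reflexive (ℤP.*-comm (+ 3) (z * + t))) (multiple≡0-mod (z * + t))))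
               (mod-reflexive (ℤP.+-identityʳ i)))
    where
      open mod-Reasoning n
      z : ℤ
      z = proj₁ (mod-quotient gj≡gi)
      e : ∀ v z t → + 3 * v * (z * t) ≡ + 3 * (z * (t * v))
      e = solve-∀
      e′ : ∀ z → + 3 * (z * + 1) ≡ z * + 3
      e′ = solve-∀
      i+3zt≡j : i + + 3 * (z * + t) ≡ j mod n
      i+3zt≡j = g-injective (begin
        g (i + + 3 * (z * + t))         ≈⟨ iterate3 i (z * + t) ⟩
        g i + + 3 * v * (z * + t)       ≡⟨ cong (λ x → g i + x) (e v z (+ t)) ⟩
        g i + + 3 * (z * (+ t * v))     ≈⟨ +-cong-mod (mod-refl {x = g i}) (*-cong-modulus 3 (*-congˡ-mod z tv≡1)) ⟩
        g i + + 3 * (z * + 1)           ≡⟨ cong (λ x → g i + x) (e′ z) ⟩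
        g i + z * + 3                   ≡⟨ proj₂ (mod-quotient gj≡gi) ⟨
        g j                             ∎)

  gap : ℤ → ℤ
  gap k = g (k + + 1) - g k

  gap-periodic : ∀ k → gap k ≡ gap (+ (k %ℕ 3)) mod n
  gap-periodic k = begin
    g (k + + 1) - g k                                        ≡⟨ cong₂ (λ i j → g i - g j) (e₁ r q k k≡r+3q) (e₂ r q k k≡r+3q) ⟩
    g ((r + + 1) + + 3 * q) - g (r + + 3 * q)                ≈⟨ +-cong-mod (iterate3 (r + + 1) q) (-‿cong-mod (iterate3 r q)) ⟩
    (g (r + + 1) + + 3 * v * q) - (g r + + 3 * v * q)        ≡⟨ e₃ (g (r + + 1)) (g r) (+ 3 * v * q) ⟩
    g (r + + 1) - g r                                        ∎
    where
      open mod-Reasoning n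
      r : ℤ
      r = + (k %ℕ 3)
      q : ℤ
      q = proj₁ (mod-quotient (%ℕ-mod 3 k))
      k≡r+3q : k ≡ r + q * + 3
      k≡r+3q = proj₂ (mod-quotient (%ℕ-mod 3 k))
      e₁ : ∀ r q k → k ≡ r + q * + 3 → k + + 1 ≡ (r + + 1) + + 3 * q
      e₁ r q k refl = e r q
        where e : ∀ r q → r + q * + 3 + + 1 ≡ (r + + 1) + + 3 * q
              e = solve-∀
      e₂ : ∀ r q k → k ≡ r + q * + 3 → k ≡ r + + 3 * q
      e₂ r q k refl = e r q
        where e : ∀ r q → r + q * + 3 ≡ r + + 3 * q
              e = solve-∀
      e₃ : ∀ x y s → (x + s) - (y + s) ≡ x - y
      e₃ = solve-∀

  a b c : ℕ
  a = gap (+ 0) %ℕ n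
  b = gap (+ 1) %ℕ n
  c = gap (+ 2) %ℕ n

  gap-residue : ∀ r → r ℕ.< 3 → gap (+ r) ≡ + pick3 a b c r mod n
  gap-residue zero                _ = %ℕ-mod n (gap (+ 0))
  gap-residue (suc zero)          _ = %ℕ-mod n (gap (+ 1))
  gap-residue (suc (suc zero))    _ = %ℕ-mod n (gap (+ 2))
  gap-residue (suc (suc (suc _))) (s≤s (s≤s (s≤s ())))

  g-step : ∀ k → g (k + + 1) ≡ g k + + sides3 a b c k mod n
  g-step k = begin
    g (k + + 1)                  ≡⟨ e (g (k + + 1)) (g k) ⟩
    g k + gap k                  ≈⟨ +-cong-mod (mod-refl {x = g k}) (mod-trans (gap-periodic k) (gap-residue _ (ℤM.n%ℕd<d k 3))) ⟩
    g k + + sides3 a b c k       ∎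
    where
      open mod-Reasoning n
      e : ∀ x y → x ≡ y + (x - y)
      e = solve-∀

  private
    telescope : ∀ x y z → (y - x) + (z - y) ≡ z - x
    telescope = solve-∀

    a≡ : + a ≡ g (+ 1) - g (+ 0) mod n
    a≡ = mod-sym (%ℕ-mod n (gap (+ 0)))

    a+b≡ : + (a ℕ.+ b) ≡ g (+ 2) - g (+ 0) mod n
    a+b≡ = mod-trans (+-cong-mod a≡ (mod-sym (%ℕ-mod n (gap (+ 1))))) (mod-reflexive (telescope (g (+ 0)) (g (+ 1)) (g (+ 2))))

    a+b+c≡ : + (a ℕ.+ b ℕ.+ c) ≡ + 3 * v mod n
    a+b+c≡ = mod-trans (+-cong-mod a+b≡ (mod-sym (%ℕ-mod n (gap (+ 2)))))
      (mod-trans (mod-reflexive (telescope (g (+ 0)) (g (+ 2)) (g (+ 3))))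
        (mod-trans (+-cong-mod (step3 (+ 0)) (mod-refl {x = - g (+ 0)})) (mod-reflexive (e (g (+ 0)) (+ 3 * v)))))
      where e : ∀ x y → x + y - x ≡ y
            e = solve-∀

    %3≡0⇒same-class : ∀ {x i j} → + x ≡ g j - g i mod n → x ℕ.% 3 ≡ 0 → j ≡ i mod 3
    %3≡0⇒same-class {x} {i} {j} x≡ x%3≡0 = same-class (+-cancelʳ-mod {z = - g i} (begin
      g j - g i     ≈⟨ mod-sym (mod-divisor (ℕD.m∣m*n m) x≡) ⟩
      + x           ≈⟨ %3≡⇒mod x x%3≡0 ⟩
      + 0           ≡⟨ ℤP.+-inverseʳ (g i) ⟨
      g i - g i     ∎))
      where open mod-Reasoning 3

    a≢0 : ¬ a ℕ.% 3 ≡ 0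
    a≢0 h = contradiction (%ℕ-cong 3 (%3≡0⇒same-class {a} {+ 0} {+ 1} a≡ h)) λ ()

    b≢0 : ¬ b ℕ.% 3 ≡ 0
    b≢0 h = contradiction (%ℕ-cong 3 (%3≡0⇒same-class {b} {+ 1} {+ 2} (mod-sym (%ℕ-mod n (gap (+ 1)))) h)) λ ()

    a+b≢0 : ¬ (a ℕ.+ b) ℕ.% 3 ≡ 0
    a+b≢0 h = contradiction (%ℕ-cong 3 (%3≡0⇒same-class {a ℕ.+ b} {+ 0} {+ 2} a+b≡ h)) λ ()

    a+b+c%3≡0 : (a ℕ.+ b ℕ.+ c) ℕ.% 3 ≡ 0
    a+b+c%3≡0 = %ℕ-cong 3 (mod-trans (mod-divisor (ℕD.m∣m*n m) a+b+c≡)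
                                     (mod-trans (mod-reflexive (ℤP.*-comm (+ 3) v)) (multiple≡0-mod v)))

    3∣a+b+c : 3 ℕD.∣ a ℕ.+ b ℕ.+ c
    3∣a+b+c = ℕD.m%n≡0⇒n∣m _ 3 a+b+c%3≡0

    u : ℕ
    u = ℕD.quotient 3∣a+b+c

    a+b+c≡3u : a ℕ.+ b ℕ.+ c ≡ 3 ℕ.* u
    a+b+c≡3u = ℕD.m∣n⇒n≡m*quotient 3∣a+b+c

    ut≡1 : + u * + t ≡ + 1 mod m
    ut≡1 = mod-trans (mod-reflexive (ℤP.*-comm (+ u) (+ t))) (mod-trans (*-congˡ-mod (+ t) u≡v) tv≡1)
      where u≡v : + u ≡ v mod m
            u≡v = *-cancel-modulus 3 (mod-trans (mod-reflexive (trans (sym (ℤP.pos-* 3 u)) (cong +_ (sym a+b+c≡3u)))) a+b+c≡)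

  periodic-sides : PeriodicSides m g
  periodic-sides = record
    { a = a ; b = b ; c = c
    ; a<n = ℤM.n%ℕd<d (gap (+ 0)) n ; b<n = ℤM.n%ℕd<d (gap (+ 1)) n ; c<n = ℤM.n%ℕd<d (gap (+ 2)) n
    ; g-step = g-step
    ; residues = classify-residues a b c a≢0 b≢0 a+b≢0 a+b+c%3≡0
    ; u = u ; a+b+c≡3u = a+b+c≡3u ; w = + t ; uw≡1 = ut≡1 }

psum-rep3 : ∀ a b c j → psum (rep3 a b c) (j ℕ.* 3) ≡ j ℕ.* (a ℕ.+ b ℕ.+ c)
psum-rep3 a b c zero    = refl
psum-rep3 a b c (suc j) = begin
  psum (rep3 a b c) (j ℕ.* 3) ℕ.+ rep3 a b c (j ℕ.* 3) ℕ.+ rep3 a b c (1 ℕ.+ j ℕ.* 3) ℕ.+ rep3 a b c (2 ℕ.+ j ℕ.* 3)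
    ≡⟨ cong₂ (λ s x → s ℕ.+ x ℕ.+ rep3 a b c (1 ℕ.+ j ℕ.* 3) ℕ.+ rep3 a b c (2 ℕ.+ j ℕ.* 3))
             (psum-rep3 a b c j) (trans (rep3≡pick3 a b c (j ℕ.* 3)) (cong (pick3 a b c) (ℕM.m*n%n≡0 j 3))) ⟩
  j ℕ.* (a ℕ.+ b ℕ.+ c) ℕ.+ a ℕ.+ rep3 a b c (1 ℕ.+ j ℕ.* 3) ℕ.+ rep3 a b c (2 ℕ.+ j ℕ.* 3)
    ≡⟨ cong₂ (λ x y → j ℕ.* (a ℕ.+ b ℕ.+ c) ℕ.+ a ℕ.+ x ℕ.+ y)
             (trans (rep3≡pick3 a b c (1 ℕ.+ j ℕ.* 3)) (cong (pick3 a b c) (ℕM.[m+kn]%n≡m%n 1 j 3)))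
             (trans (rep3≡pick3 a b c (2 ℕ.+ j ℕ.* 3)) (cong (pick3 a b c) (ℕM.[m+kn]%n≡m%n 2 j 3))) ⟩
  j ℕ.* (a ℕ.+ b ℕ.+ c) ℕ.+ a ℕ.+ b ℕ.+ c
    ≡⟨ e j a b c ⟩
  suc j ℕ.* (a ℕ.+ b ℕ.+ c) ∎
  where
    open ≡-Reasoning
    e : ∀ j a b c → j ℕ.* (a ℕ.+ b ℕ.+ c) ℕ.+ a ℕ.+ b ℕ.+ c ≡ (a ℕ.+ b ℕ.+ c) ℕ.+ j ℕ.* (a ℕ.+ b ℕ.+ c)
    e = ℕSolver.solve-∀

module TuplePath (m : ℕ) .{{_ : NonZero m}} (a b c u : ℕ) (a+b+c≡3u : a ℕ.+ b ℕ.+ c ≡ 3 ℕ.* u) where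

  n : ℕ
  n = 3 ℕ.* m

  verts : ℕ → ℤ
  verts = tupleVerts (rep3 a b c)

  τ : ℤ → ℤ
  τ = periodic n verts

  closes : + psum (rep3 a b c) n ≡ + 0 mod n
  closes = mod-trans (mod-reflexive (cong +_ psum≡)) (mod-trans (mod-reflexive (ℤP.pos-* u n)) (multiple≡0-mod (+ u)))
    where
      e : ∀ m u → m ℕ.* (3 ℕ.* u) ≡ u ℕ.* (3 ℕ.* m)
      e = ℕSolver.solve-∀
      psum≡ : psum (rep3 a b c) n ≡ u ℕ.* n
      psum≡ = trans (cong (psum (rep3 a b c)) (ℕP.*-comm 3 m))
                (trans (psum-rep3 a b c m) (trans (cong (m ℕ.*_) a+b+c≡3u) (e m u)))

  τ-step : ∀ k → τ (k + + 1) ≡ τ k + + sides3 a b c k mod n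
  τ-step k = mod-trans (mod-reflexive (cong verts (%ℕ-+1 n k))) (by-cases (nxt-cases n i))
    where
      i : ℕ
      i = k %ℕ n
      same-side : rep3 a b c i ≡ sides3 a b c k
      same-side = trans (rep3≡pick3 a b c i)
        (cong (pick3 a b c) (%ℕ-cong 3 (mod-sym (mod-divisor (ℕD.m∣m*n m) (%ℕ-mod n k)))))
      verts-suc : verts (suc i) ≡ verts i + + sides3 a b c k
      verts-suc = trans (ℤP.pos-+ (psum (rep3 a b c) i) (rep3 a b c i)) (cong (λ s → verts i + + s) same-side)
      by-cases : (suc i ≡ n × nxt n i ≡ 0) ⊎ nxt n i ≡ suc i → verts (nxt n i) ≡ verts i + + sides3 a b c k mod n
      by-cases (inj₁ (1+i≡n , nxt≡0)) = mod-trans (mod-reflexive (cong verts nxt≡0))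
        (mod-sym (mod-trans (mod-reflexive (trans (sym verts-suc) (cong verts 1+i≡n))) closes))
      by-cases (inj₂ nxt≡1+i) = mod-reflexive (trans (cong verts nxt≡1+i) verts-suc)

-- Classification of m-circular 3m-polygons

reverse : (ℤ → ℤ) → ℤ → ℤ
reverse g k = g (- k)

module _ {n : ℕ} {g : ℤ → ℤ} where

  reverse-cong : (∀ {i j} → i ≡ j mod n → g i ≡ g j) → ∀ {i j} → i ≡ j mod n → reverse g i ≡ reverse g j
  reverse-cong g-cong i≡j = g-cong (-‿cong-mod i≡j)

  reverse-injective : (∀ {i j} → g i ≡ g j mod n → i ≡ j mod n) → ∀ {i j} → reverse g i ≡ reverse g j mod n → i ≡ j mod n
  reverse-injective g-injective {i} {j} p = mod-trans (mod-reflexive (sym (ℤP.neg-involutive i)))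
    (mod-trans (-‿cong-mod (g-injective p)) (mod-reflexive (ℤP.neg-involutive j)))

Step-reverse : ∀ {n g x y} → Step n g x y → Step n (reverse g) y x
Step-reverse {g = g} (k , x≡gk , y≡gk+1) = - (k + + 1) ,
  mod-trans y≡gk+1 (mod-reflexive (cong g (sym (ℤP.neg-involutive (k + + 1))))) ,
  mod-trans x≡gk (mod-reflexive (cong g (e k)))
  where e : ∀ k → k ≡ - (- (k + + 1) + + 1)
        e = solve-∀

Step-unreverse : ∀ {n g x y} → Step n (reverse g) x y → Step n g y x
Step-unreverse {g = g} (k , x≡g-k , y≡g-k-1) = - (k + + 1) , y≡g-k-1 ,
  mod-trans x≡g-k (mod-reflexive (cong g (e k)))
  where e : ∀ k → - k ≡ - (k + + 1) + + 1
        e = solve-∀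

HasEdgeℤ-reverse : ∀ {n g x y} → HasEdgeℤ n g x y → HasEdgeℤ n (reverse g) x y
HasEdgeℤ-reverse (inj₁ s) = inj₂ (Step-reverse s)
HasEdgeℤ-reverse (inj₂ s) = inj₁ (Step-reverse s)

HasEdgeℤ-unreverse : ∀ {n g x y} → HasEdgeℤ n (reverse g) x y → HasEdgeℤ n g x y
HasEdgeℤ-unreverse (inj₁ s) = inj₂ (Step-unreverse s)
HasEdgeℤ-unreverse (inj₂ s) = inj₁ (Step-unreverse s)

reverse-traces : ∀ {n σ g} → Traces n σ g → Traces n σ (reverse g)
reverse-traces traces = mk⇔ (HasEdgeℤ-reverse ∘ Equivalence.to traces) (Equivalence.from traces ∘ HasEdgeℤ-unreverse)

module Classification (m : ℕ) .{{_ : NonZero m}} (2<m : 2 ℕ.< m) where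

  n : ℕ
  n = 3 ℕ.* m

  6<n : 6 ℕ.< n
  6<n = ℕP.*-monoʳ-< 3 2<m

  n%3≡0 : n ℕ.% 3 ≡ 0
  n%3≡0 = trans (cong (ℕ._% 3) (ℕP.*-comm 3 m)) (ℕM.m*n%n≡0 m 3)

  circular-sides : (g : ℤ → ℤ) → (∀ {i j} → i ≡ j mod n → g i ≡ g j) → (∀ {i j} → g i ≡ g j mod n → i ≡ j mod n) →
                   (∀ x y → HasEdgeℤ n g x y → HasEdgeℤ n g (x + + 3) (y + + 3)) → PeriodicSides m g
  circular-sides g periodic injective invariant =
    ShiftedPolygon.periodic-sides m g periodic injective (proj₁ shift) (proj₂ shift)
    where shift : ∃[ d ] ∀ k → g (k + + d) ≡ g k + + 3 mod n
          shift = IndexedPolygon.rotation⇒shift n g periodic injective 6<n invariant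

  module Representation (σ : ℕ → ℤ) (g : ℤ → ℤ) (traces : Traces n σ g) (no-axis : ¬ HasSymmetryAxis n σ)
                        (D : PeriodicSides m g) (ones : AllResidues 1 (PeriodicSides.a D) (PeriodicSides.b D) (PeriodicSides.c D)) where

    open PeriodicSides D
    a≡1 : a ℕ.% 3 ≡ 1
    a≡1 = proj₁ ones
    b≡1 : b ℕ.% 3 ≡ 1
    b≡1 = proj₁ (proj₂ ones)
    c≡1 : c ℕ.% 3 ≡ 1
    c≡1 = proj₂ (proj₂ ones)
    open RegularPaths m a b c a≡1 b≡1 c≡1 using (Ahead-translate; palindromic; mirror; module Path)
    module Pg = Path u a+b+c≡3u w uw≡1 g g-step
    module Tuple = TuplePath m a b c u a+b+c≡3u
    module Pτ = Path u a+b+c≡3u w uw≡1 Tuple.τ Tuple.τ-step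

    g₀ : ℤ
    g₀ = g (+ 0)

    axis : ∀ q → (∀ r → r ℕ.< 3 → pick3 a b c r ≡ sides3 a b c (+ q - + r - + 1)) → HasSymmetryAxis n σ
    axis q on-residues = mirror q g₀ , HasEdgeℤ⇒MapsOnto traces traces reflect
      (λ edge → HasEdgeℤ-resp (mod-reflexive (e (mirror q g₀) _)) (mod-reflexive (e (mirror q g₀) _)) (reflect edge))
      where
        reflect : ∀ {x y} → HasEdgeℤ n g x y → HasEdgeℤ n g (mirror q g₀ - x) (mirror q g₀ - y)
        reflect = Pg.reflect q (palindromic q on-residues)
        e : ∀ r x → r - (r - x) ≡ x
        e = solve-∀

    a≢b : ¬ a ≡ b
    a≢b a≡b = no-axis (axis 2 (below3-cases _ a≡b (sym a≡b) refl))

    b≢c : ¬ b ≡ c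
    b≢c b≡c = no-axis (axis 1 (below3-cases _ refl b≡c (sym b≡c)))

    c≢a : ¬ c ≡ a
    c≢a c≡a = no-axis (axis 0 (below3-cases _ (sym c≡a) refl c≡a))

    admissible : Admissible m a b c
    admissible = a≡1 , b≡1 , c≡1 , subst (λ z → gcd z m ≡ 1) (sym S/3≡u) (inverse⇒gcd≡1 {u} w uw≡1) ,
                 (%3≡1⇒≥1 a≡1 , %3≡1⇒≤∸2 a≡1 n%3≡0 a<n) , (%3≡1⇒≥1 b≡1 , %3≡1⇒≤∸2 b≡1 n%3≡0 b<n) ,
                 (%3≡1⇒≥1 c≡1 , %3≡1⇒≤∸2 c≡1 n%3≡0 c<n) , a≢b , b≢c , c≢a
      where S/3≡u : (a ℕ.+ b ℕ.+ c) ℕ./ 3 ≡ u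
            S/3≡u = trans (cong (ℕ._/ 3) (trans a+b+c≡3u (ℕP.*-comm 3 u))) (ℕM.m*n/n≡m u 3)

    τ₀≡0 : Tuple.τ (+ 0) ≡ + 0
    τ₀≡0 = cong Tuple.verts (ℕM.m<n⇒m%n≡m (ℕ.>-nonZero⁻¹ n))

    equivalent : Equivalent n σ (tupleVerts (rep3 a b c))
    equivalent = - g₀ , HasEdgeℤ⇒MapsOnto traces (periodic-traces n Tuple.verts) to from
      where
        to : ∀ {x y} → HasEdgeℤ n g x y → HasEdgeℤ n Tuple.τ (x - g₀) (y - g₀)
        to = HasEdgeℤ-map (_- g₀) (Pτ.Ahead⇒Step ∘ Ahead-translate origin ∘ Pg.Step⇒Ahead)
          where origin : g₀ - g₀ ≡ Tuple.τ (+ 0) mod 3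
                origin = mod-reflexive (trans (ℤP.+-inverseʳ g₀) (sym τ₀≡0))
        e : ∀ x g₀ → x - g₀ + g₀ ≡ x
        e = solve-∀
        from : ∀ {x y} → HasEdgeℤ n Tuple.τ (x - g₀) (y - g₀) → HasEdgeℤ n g x y
        from {x} {y} edge = HasEdgeℤ-resp (mod-reflexive (e x g₀)) (mod-reflexive (e y g₀))
          (HasEdgeℤ-map (_+ g₀) (Pg.Ahead⇒Step ∘ Ahead-translate origin ∘ Pτ.Step⇒Ahead) edge)
          where origin : Tuple.τ (+ 0) + g₀ ≡ g₀ mod 3
                origin = mod-reflexive (trans (cong (_+ g₀) τ₀≡0) (ℤP.+-identityˡ g₀))

  admissible⇒circular : ∀ a b c → Admissible m a b c →
                        RepresentsPolygon n (rep3 a b c) × MCircular m (tupleVerts (rep3 a b c))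
  admissible⇒circular a b c (a≡1 , b≡1 , c≡1 , gcd≡1 , (_ , a≤) , (_ , b≤) , (_ , c≤) , a≢b , b≢c , c≢a) =
    (injective⇒IsPolygon n Tuple.verts Pτ.injective , mod⇒Cong Tuple.closes) , no-axis , rotations
    where
      3∣a+b+c : 3 ℕD.∣ a ℕ.+ b ℕ.+ c
      3∣a+b+c = ℕD.m%n≡0⇒n∣m _ 3 (residues1⇒sum%3≡0 a b c a≡1 b≡1 c≡1)
      u : ℕ
      u = (a ℕ.+ b ℕ.+ c) ℕ./ 3
      a+b+c≡3u : a ℕ.+ b ℕ.+ c ≡ 3 ℕ.* u
      a+b+c≡3u = sym (ℕM.m*[n/m]≡n 3∣a+b+c)
      inverse : ∃[ w ] + u * w ≡ + 1 mod m
      inverse = coprime⇒inverse (gcd≡1⇒coprime {u} {m} gcd≡1)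
      open RegularPaths m a b c a≡1 b≡1 c≡1 using (module Path)
      module Tuple = TuplePath m a b c u a+b+c≡3u
      module Pτ = Path u a+b+c≡3u (proj₁ inverse) (proj₂ inverse) Tuple.τ Tuple.τ-step
      traces : Traces n Tuple.verts Tuple.τ
      traces = periodic-traces n Tuple.verts
      below-n : ∀ {x} → x ℕ.≤ n ℕ.∸ 2 → x ℕ.< n
      below-n x≤ = ℕP.≤-<-trans x≤ (ℕP.∸-monoʳ-< {n} {2} {0} (s≤s z≤n) (ℕP.<⇒≤ (ℕP.<-trans (s≤s (s≤s (s≤s z≤n))) 6<n)))
      no-axis : ¬ HasSymmetryAxis n Tuple.verts
      no-axis (r , maps) with Pτ.axis⇒equal-sides (below-n a≤) (below-n b≤) (below-n c≤) r
                                (λ x y → MapsOnto⇒HasEdgeℤ traces traces maps)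
      ... | inj₁ a≡b        = a≢b a≡b
      ... | inj₂ (inj₁ b≡c) = b≢c b≡c
      ... | inj₂ (inj₂ c≡a) = c≢a c≡a
      rotations : ∀ i → 1 ℕ.≤ i → i ℕ.≤ m → MapsOnto n (rot (+ (3 ℕ.* i))) Tuple.verts Tuple.verts
      rotations i _ _ = HasEdgeℤ⇒MapsOnto traces traces (Pτ.rotate 3i≡0) (Pτ.rotate⁻¹ 3i≡0)
        where 3i≡0 : + (3 ℕ.* i) ≡ + 0 mod 3
              3i≡0 = mod-trans (mod-reflexive (trans (ℤP.pos-* 3 i) (ℤP.*-comm (+ 3) (+ i)))) (multiple≡0-mod (+ i))

  last+first≡0 : ∀ {g} (D : PeriodicSides m g) (D′ : PeriodicSides m (reverse g)) →
                 + PeriodicSides.c D + + PeriodicSides.a D′ ≡ + 0 mod n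
  last+first≡0 {g} D D′ = +-cancelˡ-mod {z = g (+ 0)} (begin
    g (+ 0) + (+ c + + a′)     ≡⟨ e (g (+ 0)) (+ c) (+ a′) ⟩
    g (+ 0) + + a′ + + c       ≈⟨ +-cong-mod (mod-sym (PeriodicSides.g-step D′ (+ 0))) mod-refl ⟩
    g -[1+ 0 ] + + c           ≈⟨ mod-sym (PeriodicSides.g-step D -[1+ 0 ]) ⟩
    g (+ 0)                    ≡⟨ ℤP.+-identityʳ (g (+ 0)) ⟨
    g (+ 0) + + 0              ∎)
    where
      open mod-Reasoning n
      c a′ : ℕ
      c  = PeriodicSides.c D
      a′ = PeriodicSides.a D′
      e : ∀ x y z → x + (y + z) ≡ x + z + y
      e = solve-∀

  Representable : (ℕ → ℤ) → Set
  Representable σ = ∃[ a ] ∃[ b ] ∃[ c ] (Admissible m a b c × Equivalent n σ (tupleVerts (rep3 a b c)))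

  circular⇒representable : ∀ σ → IsPolygon n σ → MCircular m σ → Representable σ
  circular⇒representable σ polygon (no-axis , rotations) = by-residues (residues Dₛ) (residues Dρ)
    where
      open PeriodicSides using (a; b; c; residues)
      s : ℤ → ℤ
      s = periodic n σ
      traces : Traces n σ s
      traces = periodic-traces n σ
      s-injective : ∀ {i j} → s i ≡ s j mod n → i ≡ j mod n
      s-injective = IsPolygon⇒injective n σ polygon
      invariant : ∀ x y → HasEdgeℤ n s x y → HasEdgeℤ n s (x + + 3) (y + + 3)
      invariant x y = MapsOnto⇒HasEdgeℤ traces traces (rotations 1 ℕP.≤-refl (ℕ.>-nonZero⁻¹ m))
      Dₛ : PeriodicSides m s
      Dₛ = circular-sides s (periodic-cong n σ) s-injective invariant
      Dρ : PeriodicSides m (reverse s)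
      Dρ = circular-sides (reverse s) (reverse-cong (periodic-cong n σ)) (reverse-injective s-injective)
             (λ x y → HasEdgeℤ-reverse ∘ invariant x y ∘ HasEdgeℤ-unreverse)
      represent : ∀ {g} → Traces n σ g → (D : PeriodicSides m g) → AllResidues 1 (a D) (b D) (c D) → Representable σ
      represent {g} traces D ones = _ , _ , _ , R.admissible , R.equivalent
        where module R = Representation σ g traces no-axis D ones
      by-residues : AllResidues 1 (a Dₛ) (b Dₛ) (c Dₛ) ⊎ AllResidues 2 (a Dₛ) (b Dₛ) (c Dₛ) →
                    AllResidues 1 (a Dρ) (b Dρ) (c Dρ) ⊎ AllResidues 2 (a Dρ) (b Dρ) (c Dρ) → Representable σ
      by-residues (inj₁ ones) _           = represent traces Dₛ ones
      by-residues (inj₂ _)    (inj₁ ones) = represent (reverse-traces traces) Dρ ones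
      -- The last side of s and the first side of its reversal cannot both be ≡ 2 (mod 3).
      by-residues (inj₂ (_ , _ , cₛ≡2)) (inj₂ (aρ≡2 , _ , _)) = contradiction (%ℕ-cong 3 (mod-trans
        (mod-sym (+-cong-mod (%3≡⇒mod (c Dₛ) cₛ≡2) (%3≡⇒mod (a Dρ) aρ≡2)))
        (mod-divisor (ℕD.m∣m*n m) (last+first≡0 Dₛ Dρ)))) λ ()

mainTheorem4 : ∀ (m : ℕ) → 2 ℕ.< m →
    (∀ a b c → Admissible m a b c →
      RepresentsPolygon (3 ℕ.* m) (rep3 a b c) × MCircular m (tupleVerts (rep3 a b c)))
    ×
    (∀ (σ : ℕ → ℤ) → IsPolygon (3 ℕ.* m) σ → MCircular m σ →
      ∃[ a ] ∃[ b ] ∃[ c ] (Admissible m a b c ×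
        Equivalent (3 ℕ.* m) σ (tupleVerts (rep3 a b c))))
mainTheorem4 m 2<m = admissible⇒circular , circular⇒representable
  where open Classification m {{ℕ.>-nonZero (ℕP.<-trans (s≤s z≤n) 2<m)}} 2<m
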